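{- Let $k,m\ge 1$ be integers. (i) The spectrum of the integrated Laplacian matrix of $K^M_{k(m)}$ is $0^{(1)}$, $(2mk)^{(k-1)}$, $(2mk-2m)^{(2mk-k)}$. (ii) The spectrum of the integrated Laplacian matrix of $K^D_{k(m)}$ is $(2mk-2m)^{(1)}$, $0^{(1)}$, $(mk)^{(k-1)}$, $(mk-2m)^{(k-1)}$, $(mk-m)^{(2km-2k)}$. Here $\lambda^{(t)}$ denotes an eigenvalue $\lambda$ with multiplicity $t$.
   Context: A mixed graph has a finite vertex set, a multiset of edges (unordered pairs) and a multiset of arcs (ordered pairs). $K^M_{k(m)}$ is the mixed graph whose vertex set is partitioned into $k$ parts of size $m$, in which for every two vertices $u,v$ in different parts there is exactly one edge $\{u,v\}$, exactly one arc $(u,v)$ and exactly one arc $(v,u)$, and there are no other edges or arcs. $K^D_{k(m)}$ is defined the same way but with no edges (only the arcs $(u,v)$ and $(v,u)$ between different parts). For a vertex $v$, $d(v)$ is the number of edges incident with $v$, and $d^+(v)$ (resp. $d^-(v)$) the number of arcs starting (resp. ending) at $v$. For $V_G=\{v_1,\dots,v_n\}$ the integrated adjacency matrix $\mathcal{I}(G)$ is the $2n\times 2n$ matrix indexed by $v'_1,\dots,v'_n,v''_1,\dots,v''_n$ whose $(v'_i,v'_j)$ and $(v''_i,v''_j)$ entries are the number of edges joining $v_i,v_j$ (and $2\times$ number of loops when $i=j$), and whose $(v'_i,v''_j)$ and $(v''_j,v'_i)$ entries are the number of arcs from $v_i$ to $v_j$. The integrated degree matrix $\mathcal{I}^D(G)$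 is diagonal with $(v'_i,v'_i)$ entry $d(v_i)+d^+(v_i)$ and $(v''_i,v''_i)$ entry $d(v_i)+d^-(v_i)$; the integrated Laplacian matrix is $\mathcal{I}^L(G)=\mathcal{I}^D(G)-\mathcal{I}(G)$. -}

module Defs where

open import Data.Nat as ℕ using (ℕ; zero; suc)
open import Data.Integer as ℤ using (ℤ; +_; _-_; _*_; _^_)
open import Data.Fin as Fin using (Fin; zero; suc; toℕ; punchIn; splitAt; quotient)
open import Data.Sum using (inj₁; inj₂)
open import Relation.Nullary using (yes; no)
open import Relation.Nullary.Decidable using (⌊_⌋)
open import Relation.Binary.PropositionalEquality using (_≡_; refl; sym)
open import Data.Empty using (⊥-elim)
open import Data.Bool using (Bool; true; false; if_then_else_)

sumℕ : ∀ {n} → (Fin n → ℕ) → ℕ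
sumℕ {zero}  f = 0
sumℕ {suc n} f = f zero ℕ.+ sumℕ (λ i → f (suc i))

sumℤ : ∀ {n} → (Fin n → ℤ) → ℤ
sumℤ {zero}  f = + 0
sumℤ {suc n} f = f zero ℤ.+ sumℤ (λ i → f (suc i))

Matrix : ℕ → Set
Matrix n = Fin n → Fin n → ℤ

sign : ℕ → ℤ
sign zero          = + 1
sign (suc zero)    = ℤ.- (+ 1)
sign (suc (suc j)) = sign j

det : ∀ {n} → Matrix n → ℤ
det {zero}  M = + 1
det {suc n} M =
  sumℤ (λ j → sign (toℕ j) * M zero j * det (λ i l → M (suc i) (punchIn j l)))

identity : ∀ {n} → Matrix n
identity i j = if ⌊ i Fin.≟ j ⌋ then + 1 else + 0

charPoly : ∀ {n} → Matrix n → ℤ → ℤ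
charPoly M t = det (λ i j → t * identity i j - M i j)

-- Mixed graphs on vertex set Fin n, given by multiplicities:
--   edges u v = number of edges joining u and v (symmetric; edges v v
--               is the number of loops at v)
--   arcs  u v = number of arcs from u to v

record MixedGraph (n : ℕ) : Set where
  field
    edges     : Fin n → Fin n → ℕ
    arcs      : Fin n → Fin n → ℕ
    edges-sym : ∀ u v → edges u v ≡ edges v u
open MixedGraph public


edgeEntry : ∀ {n} → MixedGraph n → Fin n → Fin n → ℕ
edgeEntry G i j = if ⌊ i Fin.≟ j ⌋ then 2 ℕ.* edges G i i else edges G i j

deg : ∀ {n} → MixedGraph n → Fin n → ℕ
deg G v = sumℕ (λ u → edgeEntry G v u)

outdeg indeg : ∀ {n} → MixedGraph n → Fin n → ℕ
outdeg G v = sumℕ (λ u → arcs G v u)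
indeg  G v = sumℕ (λ u → arcs G u v)

-- Index set v'_1..v'_n, v''_1..v''_n is Fin (n + n): inj₁ = v', inj₂ = v''.

integratedAdj : ∀ {n} → MixedGraph n → Matrix (n ℕ.+ n)
integratedAdj {n} G a b with splitAt n a | splitAt n b
... | inj₁ i | inj₁ j = + edgeEntry G i j
... | inj₂ i | inj₂ j = + edgeEntry G i j
... | inj₁ i | inj₂ j = + arcs G i j
... | inj₂ j | inj₁ i = + arcs G i j

integratedDeg : ∀ {n} → MixedGraph n → Matrix (n ℕ.+ n)
integratedDeg {n} G a b with splitAt n a | splitAt n b
... | inj₁ i | inj₁ j = if ⌊ i Fin.≟ j ⌋ then + (deg G i ℕ.+ outdeg G i) else + 0
... | inj₂ i | inj₂ j = if ⌊ i Fin.≟ j ⌋ then + (deg G i ℕ.+ indeg G i) else + 0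
... | inj₁ i | inj₂ j = + 0
... | inj₂ i | inj₁ j = + 0

integratedLap : ∀ {n} → MixedGraph n → Matrix (n ℕ.+ n)
integratedLap G a b = integratedDeg G a b - integratedAdj G a b

-- Complete multipartite graphs.  Vertex set Fin (k * m); vertex i lies in
-- part  quotient m i : Fin k  (parts of size m).

diffParts : (k m : ℕ) → Fin (k ℕ.* m) → Fin (k ℕ.* m) → ℕ
diffParts k m u v = if ⌊ quotient {k} m u Fin.≟ quotient {k} m v ⌋ then 0 else 1

diffParts-sym : ∀ k m u v → diffParts k m u v ≡ diffParts k m v u
diffParts-sym k m u v with quotient {k} m u Fin.≟ quotient {k} m v
                         | quotient {k} m v Fin.≟ quotient {k} m u
... | yes _ | yes _ = refl
... | no  _ | no  _ = refl
... | yes p | no ¬q = ⊥-elim (¬q (sym p))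
... | no ¬p | yes q = ⊥-elim (¬p (sym q))

KM : (k m : ℕ) → MixedGraph (k ℕ.* m)
KM k m = record { edges = diffParts k m ; arcs = diffParts k m ; edges-sym = diffParts-sym k m }

KD : (k m : ℕ) → MixedGraph (k ℕ.* m)
KD k m = record { edges = λ _ _ → 0 ; arcs = diffParts k m ; edges-sym = λ _ _ → refl }

-- Split t·I − 𝓘ᴸ into blocks indexed by the v′ and the v″.  Both graphs are regular with
-- symmetric arcs, so the matrix is [[P, Q], [Q, P]] with P = x·I + E and Q = A, where x is t
-- minus the integrated degree, E the edge multiplicities and A the adjacency matrix of the
-- complete multipartite graph; hence its determinant is det(P + Q)·det(P − Q).  For K^M this is
-- det(x·I + 2A)·det(x·I), for K^D it is det(x·I + A)·det(x·I − A).
--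
-- Each factor x·I + z·A has the form x·I + F·Γ, where Γ is the k × km incidence matrix of the
-- partition into parts, and Sylvester's identity det(x·I + F·Γ) = x^(km−k)·det(x·I + Γ·F) leaves a
-- k × k matrix a·I + b·J, whose determinant is a^(k−1)·(a + k·b).

module Submission where

open import Defs
open import Data.Nat as ℕ using (ℕ; zero; suc; _≤_; _∸_)
import Data.Nat.Properties as ℕ
open import Data.Integer as ℤ using (ℤ; +_; _-_; _*_; _^_; _+_; -_)
import Data.Integer.Properties as ℤ
open import Data.Integer.Tactic.RingSolver using (solve-∀)
import Data.Nat.Tactic.RingSolver as ℕ-Solver
open import Data.Fin as Fin using (Fin; zero; suc; toℕ; punchIn; punchOut; _↑ˡ_; _↑ʳ_; splitAt; quotient)
import Data.Fin.Properties as Fin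
open import Data.Bool using (if_then_else_)
open import Data.Empty using (⊥-elim)
open import Data.Product using (Σ; ∃; _×_; _,_; proj₁)
open import Data.Sum using (_⊎_; inj₁; inj₂; [_,_]′)
open import Function using (_∘_)
open import Function.Definitions using (StrictlySurjective)
open import Relation.Binary.Definitions using (Monotonic₁)
open import Relation.Nullary using (yes; no; Dec)
open import Relation.Nullary.Decidable using (⌊_⌋)
open import Relation.Binary.PropositionalEquality

sum-cong : ∀ {n} {f g : Fin n → ℤ} → (∀ i → f i ≡ g i) → sumℤ f ≡ sumℤ g
sum-cong {zero}  eq = refl
sum-cong {suc n} eq = cong₂ _+_ (eq zero) (sum-cong (eq ∘ suc))

sum-zero : ∀ {n} {f : Fin n → ℤ} → (∀ i → f i ≡ + 0) → sumℤ f ≡ + 0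
sum-zero {zero}  eq = refl
sum-zero {suc n} eq = cong₂ _+_ (eq zero) (sum-zero (eq ∘ suc))

sum-distrib-+ : ∀ {n} (f g : Fin n → ℤ) → sumℤ (λ i → f i + g i) ≡ sumℤ f + sumℤ g
sum-distrib-+ {zero}  f g = refl
sum-distrib-+ {suc n} f g rewrite sum-distrib-+ (f ∘ suc) (g ∘ suc) =
  interchange (f zero) (g zero) (sumℤ (f ∘ suc)) (sumℤ (g ∘ suc))
  where
  interchange : ∀ a b c d → a + b + (c + d) ≡ a + c + (b + d)
  interchange = solve-∀

*-distribˡ-sum : ∀ {n} (c : ℤ) (f : Fin n → ℤ) → sumℤ (λ i → c * f i) ≡ c * sumℤ f
*-distribˡ-sum {zero}  c f = sym (ℤ.*-zeroʳ c)
*-distribˡ-sum {suc n} c f rewrite *-distribˡ-sum c (f ∘ suc) = sym (ℤ.*-distribˡ-+ c (f zero) _)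

*-distribʳ-sum : ∀ {n} (c : ℤ) (f : Fin n → ℤ) → sumℤ (λ i → f i * c) ≡ sumℤ f * c
*-distribʳ-sum c f = trans (sum-cong (λ i → ℤ.*-comm (f i) c))
                           (trans (*-distribˡ-sum c f) (ℤ.*-comm c (sumℤ f)))

sum-punchIn : ∀ {n} (c : Fin (suc n)) (f : Fin (suc n) → ℤ) →
              sumℤ f ≡ f c + sumℤ (f ∘ punchIn c)
sum-punchIn zero    f = refl
sum-punchIn {suc n} (suc c) f rewrite sum-punchIn c (f ∘ suc) =
  swap (f zero) (f (suc c)) (sumℤ (f ∘ suc ∘ punchIn c))
  where
  swap : ∀ a b c → a + (b + c) ≡ b + (a + c)
  swap = solve-∀

sum-supportedAt : ∀ {n} (c : Fin n) (f : Fin n → ℤ) → (∀ i → i ≢ c → f i ≡ + 0) → sumℤ f ≡ f c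
sum-supportedAt {suc n} c f off = begin
  sumℤ f                       ≡⟨ sum-punchIn c f ⟩
  f c + sumℤ (f ∘ punchIn c)   ≡⟨ cong (_+_ (f c)) (sum-zero (λ l → off (punchIn c l) (Fin.punchInᵢ≢i c l))) ⟩
  f c + + 0                    ≡⟨ ℤ.+-identityʳ (f c) ⟩
  f c                          ∎
  where open ≡-Reasoning

sum-supportedAt₂ : ∀ {n} {c d : Fin n} (f : Fin n → ℤ) → c ≢ d →
                   (∀ i → i ≢ c → i ≢ d → f i ≡ + 0) → sumℤ f ≡ f c + f d
sum-supportedAt₂ {suc n} {c} {d} f c≢d off = begin
  sumℤ f                                                     ≡⟨ sum-punchIn c f ⟩
  f c + sumℤ (f ∘ punchIn c)                                 ≡⟨ cong (_+_ (f c)) (sum-supportedAt e (f ∘ punchIn c) off′) ⟩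
  f c + f (punchIn c e)                                      ≡⟨ cong (λ j → f c + f j) (Fin.punchIn-punchOut c≢d) ⟩
  f c + f d                                                  ∎
  where
  open ≡-Reasoning
  e = punchOut c≢d
  off′ : ∀ l → l ≢ e → f (punchIn c l) ≡ + 0
  off′ l l≢e = off (punchIn c l) (Fin.punchInᵢ≢i c l)
    (λ eq → l≢e (Fin.punchIn-injective c l e (trans eq (sym (Fin.punchIn-punchOut c≢d)))))

sum-const : ∀ n (a : ℤ) → sumℤ {n} (λ _ → a) ≡ + n * a
sum-const zero    a = refl
sum-const (suc n) a rewrite sum-const n a = step a (+ n)
  where
  step : ∀ a n → a + n * a ≡ (+ 1 + n) * a
  step = solve-∀

sum-splitAt : ∀ p q (f : Fin (p ℕ.+ q) → ℤ) →
              sumℤ f ≡ sumℤ (λ i → f (i ↑ˡ q)) + sumℤ (λ j → f (p ↑ʳ j))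
sum-splitAt zero    q f = sym (ℤ.+-identityˡ (sumℤ f))
sum-splitAt (suc p) q f rewrite sum-splitAt p q (f ∘ suc) =
  sym (ℤ.+-assoc (f zero) (sumℤ (λ i → f (suc (i ↑ˡ q)))) (sumℤ (λ j → f (suc (p ↑ʳ j)))))

sumℕ-cong : ∀ {n} {f g : Fin n → ℕ} → (∀ i → f i ≡ g i) → sumℕ f ≡ sumℕ g
sumℕ-cong {zero}  eq = refl
sumℕ-cong {suc n} eq = cong₂ ℕ._+_ (eq zero) (sumℕ-cong (eq ∘ suc))

sumℕ-zero : ∀ {n} {f : Fin n → ℕ} → (∀ i → f i ≡ 0) → sumℕ f ≡ 0
sumℕ-zero {zero}  eq = refl
sumℕ-zero {suc n} eq = cong₂ ℕ._+_ (eq zero) (sumℕ-zero (eq ∘ suc))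

+-sumℕ : ∀ {n} (f : Fin n → ℕ) → + sumℕ f ≡ sumℤ (λ i → + f i)
+-sumℕ {zero}  f = refl
+-sumℕ {suc n} f = trans (ℤ.pos-+ (f zero) (sumℕ (f ∘ suc))) (cong (_+_ (+ f zero)) (+-sumℕ (f ∘ suc)))

identity-diag : ∀ {n} (i : Fin n) → identity i i ≡ + 1
identity-diag i with i Fin.≟ i
... | yes _  = refl
... | no i≢i = ⊥-elim (i≢i refl)

identity-offDiag : ∀ {n} {i j : Fin n} → i ≢ j → identity i j ≡ + 0
identity-offDiag {i = i} {j} i≢j with i Fin.≟ j
... | yes i≡j = ⊥-elim (i≢j i≡j)
... | no _    = refl

identity-reindex : ∀ {n m} (f : Fin n → Fin m) → (∀ {a b} → f a ≡ f b → a ≡ b) →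
                   ∀ i j → identity (f i) (f j) ≡ identity i j
identity-reindex f f-inj i j with i Fin.≟ j
... | yes refl = identity-diag (f i)
... | no i≢j   = identity-offDiag (i≢j ∘ f-inj)

identity-*-transport : ∀ {n} (i j : Fin n) (g : Fin n → ℤ) → identity i j * g i ≡ identity i j * g j
identity-*-transport i j g with i Fin.≟ j
... | yes refl = refl
... | no _     = refl

sum-identity-* : ∀ {n} (c : Fin n) (f : Fin n → ℤ) → sumℤ (λ i → identity i c * f i) ≡ f c
sum-identity-* c f =
  trans (sum-supportedAt c _ (λ i i≢c → trans (cong (_* f i) (identity-offDiag i≢c)) (ℤ.*-zeroˡ (f i))))
        (trans (cong (_* f c) (identity-diag c)) (ℤ.*-identityˡ (f c)))

sign-suc : ∀ n → sign (suc n) ≡ - sign n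
sign-suc zero          = refl
sign-suc (suc zero)    = refl
sign-suc (suc (suc n)) = sign-suc n

sign-+ : ∀ a b → sign (a ℕ.+ b) ≡ sign a * sign b
sign-+ zero    b = sym (ℤ.*-identityˡ (sign b))
sign-+ (suc a) b rewrite sign-suc (a ℕ.+ b) | sign-suc a | sign-+ a b = ℤ.neg-distribˡ-* (sign a) (sign b)

sign-double : ∀ a → sign (a ℕ.+ a) ≡ + 1
sign-double a = trans (sign-+ a a) (square a)
  where
  square : ∀ a → sign a * sign a ≡ + 1
  square zero          = refl
  square (suc zero)    = refl
  square (suc (suc a)) = square a

sign-punchIn-punchOut : ∀ {n} (c : Fin (suc (suc n))) (l : Fin (suc n)) (p : punchIn c l ≢ c) →
                        sign (toℕ (punchIn c l)) * sign (toℕ (punchOut p)) ≡ - (sign (toℕ l) * sign (toℕ c))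
sign-punchIn-punchOut zero l p rewrite sign-suc (toℕ l) = lemma (sign (toℕ l))
  where
  lemma : ∀ a → - a * + 1 ≡ - (a * + 1)
  lemma = solve-∀
sign-punchIn-punchOut (suc c) zero p rewrite sign-suc (toℕ c) = lemma (sign (toℕ c))
  where
  lemma : ∀ a → + 1 * a ≡ - (+ 1 * - a)
  lemma = solve-∀
sign-punchIn-punchOut {suc n} (suc c) (suc l) p
  rewrite sign-suc (toℕ (punchIn c l)) | sign-suc (toℕ (punchOut (p ∘ cong suc)))
        | sign-suc (toℕ l) | sign-suc (toℕ c) =
  trans (negate² (sign (toℕ (punchIn c l))) (sign (toℕ (punchOut (p ∘ cong suc)))))
        (trans (sign-punchIn-punchOut c l (p ∘ cong suc)) (sym (cong -_ (negate² (sign (toℕ l)) (sign (toℕ c))))))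
  where
  negate² : ∀ a b → - a * - b ≡ a * b
  negate² = solve-∀

punchIn-exchange : ∀ {n} (c : Fin (suc (suc n))) (l : Fin (suc n)) (p : punchIn c l ≢ c) (l′ : Fin n) →
                   punchIn (punchIn c l) (punchIn (punchOut p) l′) ≡ punchIn c (punchIn l l′)
punchIn-exchange zero    l       p l′       = refl
punchIn-exchange (suc c) zero    p l′       = refl
punchIn-exchange {suc n} (suc c) (suc l) p zero     = refl
punchIn-exchange {suc n} (suc c) (suc l) p (suc l′) = cong suc (punchIn-exchange c l (p ∘ cong suc) l′)

det-cong : ∀ {n} {M N : Matrix n} → (∀ i j → M i j ≡ N i j) → det M ≡ det N
det-cong {zero}  eq = refl
det-cong {suc n} eq =
  sum-cong (λ j → cong₂ (λ a b → sign (toℕ j) * a * b) (eq zero j) (det-cong (λ i l → eq (suc i) (punchIn j l))))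

minor : ∀ {n} → Matrix (suc n) → Fin (suc n) → Fin (suc n) → Matrix n
minor M r c i l = M (punchIn r i) (punchIn c l)

firstRowTerm : ∀ {n} → Matrix (suc n) → Fin (suc n) → ℤ
firstRowTerm M j = sign (toℕ j) * M zero j * det (minor M zero j)

-- Column c ≢ j of M is column  punchOut j≢c  of  minor M r j.
minor-off-column : ∀ {n} (M N : Matrix (suc n)) (r : Fin (suc n)) {c j} (j≢c : j ≢ c) →
                   (∀ i l → l ≢ c → M i l ≡ N i l) →
                   ∀ i l → l ≢ punchOut j≢c → minor M r j i l ≡ minor N r j i l
minor-off-column M N r {c} {j} j≢c eq i l l≢c′ =
  eq (punchIn r i) (punchIn j l)
     (λ e → l≢c′ (Fin.punchIn-injective j l _ (trans e (sym (Fin.punchIn-punchOut j≢c)))))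

det-linear-column : ∀ {n} (c : Fin n) (k : ℤ) (M₁ M₂ M : Matrix n) →
                    (∀ i j → j ≢ c → M₁ i j ≡ M i j) → (∀ i j → j ≢ c → M₂ i j ≡ M i j) →
                    (∀ i → M i c ≡ M₁ i c + k * M₂ i c) → det M ≡ det M₁ + k * det M₂
det-linear-column {suc n} c k M₁ M₂ M off₁ off₂ at-c = begin
  sumℤ (firstRowTerm M)                                    ≡⟨ sum-cong termwise ⟩
  sumℤ (λ j → firstRowTerm M₁ j + k * firstRowTerm M₂ j)  ≡⟨ sum-distrib-+ (firstRowTerm M₁) (λ j → k * firstRowTerm M₂ j) ⟩
  det M₁ + sumℤ (λ j → k * firstRowTerm M₂ j)             ≡⟨ cong (_+_ (det M₁)) (*-distribˡ-sum k (firstRowTerm M₂)) ⟩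
  det M₁ + k * det M₂                                      ∎
  where
  open ≡-Reasoning
  distrib-entry : ∀ k s a b d → s * (a + k * b) * d ≡ s * a * d + k * (s * b * d)
  distrib-entry = solve-∀
  distrib-minor : ∀ k s a d₁ d₂ → s * a * (d₁ + k * d₂) ≡ s * a * d₁ + k * (s * a * d₂)
  distrib-minor = solve-∀
  termwise : ∀ j → firstRowTerm M j ≡ firstRowTerm M₁ j + k * firstRowTerm M₂ j
  termwise j with j Fin.≟ c
  ... | yes refl =
    trans (cong (λ a → sign (toℕ j) * a * det (minor M zero j)) (at-c zero))
          (trans (distrib-entry k (sign (toℕ j)) (M₁ zero j) (M₂ zero j) (det (minor M zero j)))
                 (cong₂ (λ d₁ d₂ → sign (toℕ j) * M₁ zero j * d₁ + k * (sign (toℕ j) * M₂ zero j * d₂))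
                        (det-cong (λ i l → sym (off₁ (suc i) (punchIn j l) (Fin.punchInᵢ≢i j l))))
                        (det-cong (λ i l → sym (off₂ (suc i) (punchIn j l) (Fin.punchInᵢ≢i j l))))))
  ... | no j≢c =
    trans (cong (sign (toℕ j) * M zero j *_) minor-linear)
          (trans (distrib-minor k (sign (toℕ j)) (M zero j) _ _)
                 (cong₂ (λ a b → sign (toℕ j) * a * det (minor M₁ zero j) + k * (sign (toℕ j) * b * det (minor M₂ zero j)))
                        (sym (off₁ zero j j≢c)) (sym (off₂ zero j j≢c))))
    where
    minor-linear : det (minor M zero j) ≡ det (minor M₁ zero j) + k * det (minor M₂ zero j)
    minor-linear =
      det-linear-column (punchOut j≢c) k (minor M₁ zero j) (minor M₂ zero j) (minor M zero j)
        (minor-off-column M₁ M zero j≢c off₁) (minor-off-column M₂ M zero j≢c off₂)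
        (λ i → subst (λ l → M (suc i) l ≡ M₁ (suc i) l + k * M₂ (suc i) l)
                     (sym (Fin.punchIn-punchOut j≢c)) (at-c (suc i)))

det-zero-column : ∀ {n} (c : Fin n) (M : Matrix n) → (∀ i → M i c ≡ + 0) → det M ≡ + 0
det-zero-column c M zero-at-c =
  self-double⇒0 (det M) (det-linear-column c (+ 1) M M M (λ _ _ _ → refl) (λ _ _ _ → refl)
    (λ i → trans (zero-at-c i) (sym (cong₂ (λ a b → a + + 1 * b) (zero-at-c i) (zero-at-c i)))))
  where
  self-double⇒0 : ∀ x → x ≡ x + + 1 * x → x ≡ + 0
  self-double⇒0 x e = trans (cancel x) (trans (cong (_- x) (sym e)) (ℤ.+-inverseʳ x))
    where
    cancel : ∀ x → x ≡ (x + + 1 * x) - x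
    cancel = solve-∀

det-unit-column : ∀ {n} (M : Matrix (suc n)) (r c : Fin (suc n)) → (∀ i → i ≢ r → M i c ≡ + 0) →
                  det M ≡ sign (toℕ r ℕ.+ toℕ c) * M r c * det (minor M r c)
det-unit-column M zero c off = sum-supportedAt c (firstRowTerm M) vanish
  where
  vanish : ∀ j → j ≢ c → firstRowTerm M j ≡ + 0
  vanish j j≢c =
    trans (cong (sign (toℕ j) * M zero j *_)
                (det-zero-column (punchOut j≢c) (minor M zero j)
                  (λ i → trans (cong (M (suc i)) (Fin.punchIn-punchOut j≢c)) (off (suc i) λ ()))))
          (ℤ.*-zeroʳ (sign (toℕ j) * M zero j))
det-unit-column {suc n} M (suc r) c off = begin
  sumℤ (firstRowTerm M)                                          ≡⟨ sum-punchIn c (firstRowTerm M) ⟩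
  firstRowTerm M c + sumℤ (firstRowTerm M ∘ punchIn c)           ≡⟨ cong (_+ sumℤ (firstRowTerm M ∘ punchIn c)) term-c ⟩
  + 0 + sumℤ (firstRowTerm M ∘ punchIn c)                        ≡⟨ ℤ.+-identityˡ _ ⟩
  sumℤ (firstRowTerm M ∘ punchIn c)                              ≡⟨ sum-cong term ⟩
  sumℤ (λ l → s * x * firstRowTerm (minor M (suc r) c) l)        ≡⟨ *-distribˡ-sum (s * x) (firstRowTerm (minor M (suc r) c)) ⟩
  s * x * det (minor M (suc r) c)                                ∎
  where
  open ≡-Reasoning
  s = sign (suc (toℕ r) ℕ.+ toℕ c)
  x = M (suc r) c
  term-c : firstRowTerm M c ≡ + 0
  term-c = trans (cong (λ a → sign (toℕ c) * a * det (minor M zero c)) (off zero λ ()))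
                 (trans (cong (_* det (minor M zero c)) (ℤ.*-zeroʳ (sign (toℕ c)))) (ℤ.*-zeroˡ (det (minor M zero c))))
  regroup : ∀ sj a u x D v sl → sj * u ≡ v * sl → sj * a * (u * x * D) ≡ v * x * (sl * a * D)
  regroup sj a u x D v sl e = trans (l₁ sj a u x D) (trans (cong (_* (a * x * D)) e) (l₂ v sl a x D))
    where
    l₁ : ∀ sj a u x D → sj * a * (u * x * D) ≡ (sj * u) * (a * x * D)
    l₁ = solve-∀
    l₂ : ∀ v sl a x D → (v * sl) * (a * x * D) ≡ v * x * (sl * a * D)
    l₂ = solve-∀
  sign-identity : ∀ l (p : punchIn c l ≢ c) →
                  sign (toℕ (punchIn c l)) * sign (toℕ r ℕ.+ toℕ (punchOut p)) ≡ s * sign (toℕ l)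
  sign-identity l p rewrite sign-+ (toℕ r) (toℕ (punchOut p)) | sign-suc (toℕ r ℕ.+ toℕ c) | sign-+ (toℕ r) (toℕ c) =
    trans (l₁ (sign (toℕ (punchIn c l))) (sign (toℕ r)) (sign (toℕ (punchOut p))))
          (trans (cong (sign (toℕ r) *_) (sign-punchIn-punchOut c l p)) (l₂ (sign (toℕ r)) (sign (toℕ l)) (sign (toℕ c))))
    where
    l₁ : ∀ a b c → a * (b * c) ≡ b * (a * c)
    l₁ = solve-∀
    l₂ : ∀ a b c → a * - (b * c) ≡ - (a * c) * b
    l₂ = solve-∀
  term : ∀ l → firstRowTerm M (punchIn c l) ≡ s * x * firstRowTerm (minor M (suc r) c) l
  term l = trans (cong (sign (toℕ j) * M zero j *_) minor-expansion)
                 (regroup (sign (toℕ j)) (M zero j) (sign (toℕ r ℕ.+ toℕ c′)) x _ s (sign (toℕ l)) (sign-identity l p))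
    where
    j = punchIn c l
    p = Fin.punchInᵢ≢i c l
    c′ = punchOut p
    minor-expansion : det (minor M zero j) ≡ sign (toℕ r ℕ.+ toℕ c′) * x * det (minor (minor M (suc r) c) zero l)
    minor-expansion =
      trans (det-unit-column (minor M zero j) r c′
               (λ i i≢r → trans (cong (M (suc i)) (Fin.punchIn-punchOut p)) (off (suc i) (i≢r ∘ Fin.suc-injective))))
            (cong₂ (λ a D → sign (toℕ r ℕ.+ toℕ c′) * a * D)
                   (cong (M (suc r)) (Fin.punchIn-punchOut p))
                   (det-cong (λ i l′ → cong (M (suc (punchIn r i))) (punchIn-exchange c l p l′))))

setColumn : ∀ {n} → Matrix n → Fin n → (Fin n → ℤ) → Matrix n
setColumn M c v i j = if ⌊ j Fin.≟ c ⌋ then v i else M i j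

setColumn-≢ : ∀ {n} (M : Matrix n) c v i {j} → j ≢ c → setColumn M c v i j ≡ M i j
setColumn-≢ M c v i {j} j≢c with j Fin.≟ c
... | yes j≡c = ⊥-elim (j≢c j≡c)
... | no _    = refl

setColumn-≡ : ∀ {n} (M : Matrix n) c v i → setColumn M c v i c ≡ v i
setColumn-≡ M c v i with c Fin.≟ c
... | yes _  = refl
... | no c≢c = ⊥-elim (c≢c refl)

det-column-sum : ∀ {n} k (α : Fin k → ℤ) (V : Fin k → Fin n → ℤ) (c : Fin n) (M : Matrix n) →
                 det (setColumn M c (λ i → sumℤ (λ a → α a * V a i)))
                 ≡ sumℤ (λ a → α a * det (setColumn M c (V a)))
det-column-sum zero    α V c M = det-zero-column c _ (setColumn-≡ M c _)
det-column-sum (suc k) α V c M =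
  trans (det-linear-column c (α zero) (setColumn M c rest) (setColumn M c (V zero)) (setColumn M c all)
          (λ i j j≢c → trans (setColumn-≢ M c rest i j≢c) (sym (setColumn-≢ M c all i j≢c)))
          (λ i j j≢c → trans (setColumn-≢ M c (V zero) i j≢c) (sym (setColumn-≢ M c all i j≢c)))
          (λ i → trans (setColumn-≡ M c all i)
                   (trans (ℤ.+-comm (α zero * V zero i) (rest i))
                     (sym (cong₂ (λ a b → a + α zero * b) (setColumn-≡ M c rest i) (setColumn-≡ M c (V zero) i))))))
        (trans (cong (_+ α zero * det (setColumn M c (V zero))) (det-column-sum k (α ∘ suc) (V ∘ suc) c M))
               (ℤ.+-comm _ (α zero * det (setColumn M c (V zero)))))
  where
  rest all : _ → ℤ
  rest i = sumℤ (λ a → α (suc a) * V (suc a) i)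
  all  i = sumℤ (λ a → α a * V a i)

det-column-expansion : ∀ {n} (N : Matrix (suc n)) (c : Fin (suc n)) →
                       det N ≡ sumℤ (λ i → sign (toℕ i ℕ.+ toℕ c) * N i c * det (minor N i c))
det-column-expansion N c = begin
  det N                                                ≡⟨ det-cong column-as-sum ⟩
  det (setColumn N c (λ i → sumℤ (λ a → N a c * identity a i)))
                                                       ≡⟨ det-column-sum _ (λ a → N a c) identity c N ⟩
  sumℤ (λ a → N a c * det (setColumn N c (identity a))) ≡⟨ sum-cong unit ⟩
  sumℤ (λ i → sign (toℕ i ℕ.+ toℕ c) * N i c * det (minor N i c)) ∎
  where
  open ≡-Reasoning
  column-as-sum : ∀ i j → N i j ≡ setColumn N c (λ i → sumℤ (λ a → N a c * identity a i)) i j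
  column-as-sum i j with j Fin.≟ c
  ... | no _     = refl
  ... | yes refl = sym (trans (sum-cong (λ a → ℤ.*-comm (N a j) (identity a i))) (sum-identity-* i (λ a → N a j)))
  unit : ∀ a → N a c * det (setColumn N c (identity a)) ≡ sign (toℕ a ℕ.+ toℕ c) * N a c * det (minor N a c)
  unit a = trans (cong (N a c *_) (det-unit-column (setColumn N c (identity a)) a c
                   (λ i i≢a → trans (setColumn-≡ N c (identity a) i) (identity-offDiag (i≢a ∘ sym)))))
                 (trans (cong₂ (λ u D → N a c * (sign (toℕ a ℕ.+ toℕ c) * u * D))
                          (trans (setColumn-≡ N c (identity a) a) (identity-diag a))
                          (det-cong (λ i l → setColumn-≢ N c (identity a) (punchIn a i) (Fin.punchInᵢ≢i c l))))
                        (regroup (N a c) (sign (toℕ a ℕ.+ toℕ c)) (det (minor N a c))))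
    where
    regroup : ∀ a s d → a * (s * + 1 * d) ≡ s * a * d
    regroup = solve-∀

-- Expanding both minors along the column where the two equal columns meet gives the same
-- terms with opposite signs.
firstRowTerm-cancel : ∀ {n} (M : Matrix (suc (suc n))) (c : Fin (suc (suc n))) (e : Fin (suc n)) →
                      (∀ i → M i c ≡ M i (punchIn c e)) → firstRowTerm M c + firstRowTerm M (punchIn c e) ≡ + 0
firstRowTerm-cancel {n} M c e equal = begin
  sign (toℕ c) * w * det (minor M zero c) + sign (toℕ d) * M zero d * det (minor M zero d)
    ≡⟨ cong₂ _+_ (cong (sign (toℕ c) * w *_) expand-c)
                 (cong₂ (λ x y → sign (toℕ d) * x * y) (sym (equal zero)) expand-d) ⟩
  sign (toℕ c) * w * sumℤ (λ i → sign (toℕ i ℕ.+ toℕ e) * v i * E i)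
    + sign (toℕ d) * w * sumℤ (λ i → sign (toℕ i ℕ.+ toℕ e′) * v i * E i)
    ≡⟨ sym (cong₂ _+_ (*-distribˡ-sum (sign (toℕ c) * w) (λ i → sign (toℕ i ℕ.+ toℕ e) * v i * E i))
                      (*-distribˡ-sum (sign (toℕ d) * w) (λ i → sign (toℕ i ℕ.+ toℕ e′) * v i * E i))) ⟩
  sumℤ (λ i → sign (toℕ c) * w * (sign (toℕ i ℕ.+ toℕ e) * v i * E i))
    + sumℤ (λ i → sign (toℕ d) * w * (sign (toℕ i ℕ.+ toℕ e′) * v i * E i))
    ≡⟨ sym (sum-distrib-+ (λ i → sign (toℕ c) * w * (sign (toℕ i ℕ.+ toℕ e) * v i * E i))
                          (λ i → sign (toℕ d) * w * (sign (toℕ i ℕ.+ toℕ e′) * v i * E i))) ⟩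
  sumℤ (λ i → sign (toℕ c) * w * (sign (toℕ i ℕ.+ toℕ e) * v i * E i)
              + sign (toℕ d) * w * (sign (toℕ i ℕ.+ toℕ e′) * v i * E i))
    ≡⟨ sum-zero pairwise ⟩
  + 0 ∎
  where
  open ≡-Reasoning
  d = punchIn c e
  p : d ≢ c
  p = Fin.punchInᵢ≢i c e
  e′ = punchOut p
  w = M zero c
  v : Fin (suc n) → ℤ
  v i = M (suc i) d
  E : Fin (suc n) → ℤ
  E i = det (λ a b → M (suc (punchIn i a)) (punchIn c (punchIn e b)))
  expand-c : det (minor M zero c) ≡ sumℤ (λ i → sign (toℕ i ℕ.+ toℕ e) * v i * E i)
  expand-c = det-column-expansion (minor M zero c) e
  expand-d : det (minor M zero d) ≡ sumℤ (λ i → sign (toℕ i ℕ.+ toℕ e′) * v i * E i)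
  expand-d = trans (det-column-expansion (minor M zero d) e′)
    (sum-cong (λ i → cong₂ (λ x y → sign (toℕ i ℕ.+ toℕ e′) * x * y)
                (trans (cong (M (suc i)) (Fin.punchIn-punchOut p)) (equal (suc i)))
                (det-cong (λ a b → cong (M (suc (punchIn i a))) (punchIn-exchange c e p b)))))
  factor : ∀ sc w x sd y v E → sc * w * (x * v * E) + sd * w * (y * v * E) ≡ w * v * E * (sc * x + sd * y)
  factor = solve-∀
  opposite-signs : ∀ si sc se sd se′ → sd * se′ ≡ - (se * sc) → sc * (si * se) + sd * (si * se′) ≡ + 0
  opposite-signs si sc se sd se′ h = trans (l₁ si sc se sd se′) (trans (cong (λ z → si * (sc * se + z)) h) (l₂ si sc se))
    where
    l₁ : ∀ si sc se sd se′ → sc * (si * se) + sd * (si * se′) ≡ si * (sc * se + sd * se′)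
    l₁ = solve-∀
    l₂ : ∀ si sc se → si * (sc * se + - (se * sc)) ≡ + 0
    l₂ = solve-∀
  pairwise : ∀ i → sign (toℕ c) * w * (sign (toℕ i ℕ.+ toℕ e) * v i * E i)
                   + sign (toℕ d) * w * (sign (toℕ i ℕ.+ toℕ e′) * v i * E i) ≡ + 0
  pairwise i =
    trans (factor (sign (toℕ c)) w (sign (toℕ i ℕ.+ toℕ e)) (sign (toℕ d)) (sign (toℕ i ℕ.+ toℕ e′)) (v i) (E i))
          (trans (cong (w * v i * E i *_)
                   (subst₂ (λ x y → sign (toℕ c) * x + sign (toℕ d) * y ≡ + 0)
                     (sym (sign-+ (toℕ i) (toℕ e))) (sym (sign-+ (toℕ i) (toℕ e′)))
                     (opposite-signs (sign (toℕ i)) (sign (toℕ c)) (sign (toℕ e)) (sign (toℕ d)) (sign (toℕ e′))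
                       (sign-punchIn-punchOut c e p))))
                 (ℤ.*-zeroʳ (w * v i * E i)))

EqualColumnsVanish : ℕ → Set
EqualColumnsVanish n = ∀ (M : Matrix n) {c d : Fin n} → c ≢ d → (∀ i → M i c ≡ M i d) → det M ≡ + 0

equal-columns-step : ∀ {n} → EqualColumnsVanish (suc n) → EqualColumnsVanish (suc (suc n))
equal-columns-step ih M {c} {d} c≢d equal =
  trans (sum-supportedAt₂ (firstRowTerm M) c≢d others)
        (trans (cong (λ x → firstRowTerm M c + firstRowTerm M x) (sym (Fin.punchIn-punchOut c≢d)))
               (firstRowTerm-cancel M c (punchOut c≢d)
                 (λ i → trans (equal i) (cong (M i) (sym (Fin.punchIn-punchOut c≢d))))))
  where
  others : ∀ j → j ≢ c → j ≢ d → firstRowTerm M j ≡ + 0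
  others j j≢c j≢d =
    trans (cong (sign (toℕ j) * M zero j *_)
                (ih (minor M zero j) (c≢d ∘ Fin.punchOut-injective j≢c j≢d)
                  (λ i → trans (cong (M (suc i)) (Fin.punchIn-punchOut j≢c))
                               (trans (equal (suc i)) (cong (M (suc i)) (sym (Fin.punchIn-punchOut j≢d)))))))
          (ℤ.*-zeroʳ (sign (toℕ j) * M zero j))

det-equal-columns : ∀ {n} → EqualColumnsVanish n
det-equal-columns {suc zero}    M {zero} {zero} c≢d _ = ⊥-elim (c≢d refl)
det-equal-columns {suc (suc n)} = equal-columns-step det-equal-columns

det-transpose : ∀ {n} (M : Matrix n) → det (λ i j → M j i) ≡ det M
det-transpose {zero}  M = refl
det-transpose {suc n} M =
  trans (sum-cong (λ j → cong₂ (λ t D → sign t * M j zero * D) (sym (ℕ.+-identityʳ (toℕ j))) (det-transpose (minor M j zero))))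
        (sym (det-column-expansion M zero))

det-add-column-multiple : ∀ {n} (M N : Matrix n) {c d : Fin n} (k : ℤ) → c ≢ d →
                          (∀ i j → j ≢ c → N i j ≡ M i j) → (∀ i → N i c ≡ M i c + k * M i d) → det N ≡ det M
det-add-column-multiple M N {c} {d} k c≢d off at-c = begin
  det N                   ≡⟨ det-linear-column c k M M′ N (λ i j j≢c → sym (off i j j≢c))
                               (λ i j j≢c → trans (setColumn-≢ M c (λ i → M i d) i j≢c) (sym (off i j j≢c)))
                               (λ i → trans (at-c i) (cong (λ z → M i c + k * z) (sym (setColumn-≡ M c (λ i → M i d) i)))) ⟩
  det M + k * det M′      ≡⟨ cong (λ z → det M + k * z) (det-equal-columns M′ c≢d
                               (λ i → trans (setColumn-≡ M c (λ i → M i d) i)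
                                            (sym (setColumn-≢ M c (λ i → M i d) i (c≢d ∘ sym))))) ⟩
  det M + k * + 0         ≡⟨ cong (_+_ (det M)) (ℤ.*-zeroʳ k) ⟩
  det M + + 0             ≡⟨ ℤ.+-identityʳ (det M) ⟩
  det M                   ∎
  where
  open ≡-Reasoning
  M′ = setColumn M c (λ i → M i d)

det-add-row-multiple : ∀ {n} (M N : Matrix n) {c d : Fin n} (k : ℤ) → c ≢ d →
                       (∀ i j → i ≢ c → N i j ≡ M i j) → (∀ j → N c j ≡ M c j + k * M d j) → det N ≡ det M
det-add-row-multiple M N k c≢d off at-c =
  trans (sym (det-transpose N))
        (trans (det-add-column-multiple (λ i j → M j i) (λ i j → N j i) k c≢d (λ i j j≢c → off j i j≢c) at-c)
               (det-transpose M))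

RowUnchanged : ∀ {n} → Matrix n → Matrix n → Fin n → Set
RowUnchanged M N i = ∀ j → N i j ≡ M i j

RowOperation : ∀ {n} → Matrix n → Matrix n → Fin n → Set
RowOperation {n} M N i =
  RowUnchanged M N i ⊎ Σ (Fin n) λ s → Σ ℤ λ k → RowUnchanged M N s × (∀ j → N i j ≡ M i j + k * M s j)

-- Row operations are performed one row at a time: the q-th intermediate matrix takes its first
-- q rows from N and the others from M.
firstRowsFrom : ∀ {n} → ℕ → Matrix n → Matrix n → Matrix n
firstRowsFrom q N M i j = if ⌊ toℕ i ℕ.<? q ⌋ then N i j else M i j

module _ {n} (M N : Matrix n) where

  firstRowsFrom-all : ∀ i j → firstRowsFrom n N M i j ≡ N i j
  firstRowsFrom-all i j with toℕ i ℕ.<? n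
  ... | yes _ = refl
  ... | no i≮n = ⊥-elim (i≮n (Fin.toℕ<n i))

  firstRowsFrom-other : ∀ q i j → toℕ i ≢ q → firstRowsFrom (suc q) N M i j ≡ firstRowsFrom q N M i j
  firstRowsFrom-other q i j i≢q with toℕ i ℕ.<? suc q | toℕ i ℕ.<? q
  ... | yes _     | yes _   = refl
  ... | no _      | no _    = refl
  ... | yes i<1+q | no i≮q  = ⊥-elim (i≮q (ℕ.≤∧≢⇒< (ℕ.≤-pred i<1+q) i≢q))
  ... | no i≮1+q  | yes i<q = ⊥-elim (i≮1+q (ℕ.m<n⇒m<1+n i<q))

  firstRowsFrom-new : ∀ q i j → toℕ i ≡ q → firstRowsFrom (suc q) N M i j ≡ N i j
  firstRowsFrom-new q i j refl with toℕ i ℕ.<? suc (toℕ i)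
  ... | yes _    = refl
  ... | no i≮1+i = ⊥-elim (i≮1+i (ℕ.n<1+n (toℕ i)))

  firstRowsFrom-old : ∀ q i j → toℕ i ≡ q → firstRowsFrom q N M i j ≡ M i j
  firstRowsFrom-old q i j refl with toℕ i ℕ.<? toℕ i
  ... | yes i<i = ⊥-elim (ℕ.<-irrefl refl i<i)
  ... | no _    = refl

  firstRowsFrom-unchanged : ∀ q s j → RowUnchanged M N s → firstRowsFrom q N M s j ≡ M s j
  firstRowsFrom-unchanged q s j unchanged with toℕ s ℕ.<? q
  ... | yes _ = unchanged j
  ... | no _  = refl

  det-firstRowsFrom-suc : (∀ i → RowOperation M N i) → ∀ q → det (firstRowsFrom (suc q) N M) ≡ det (firstRowsFrom q N M)
  det-firstRowsFrom-suc op q with q ℕ.<? n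
  ... | no q≮n = det-cong (λ i j → firstRowsFrom-other q i j (λ i≡q → q≮n (subst (ℕ._< n) i≡q (Fin.toℕ<n i))))
  ... | yes q<n = operate (op d)
    where
    B = firstRowsFrom q N M
    B′ = firstRowsFrom (suc q) N M
    d = Fin.fromℕ< q<n
    at-d : toℕ d ≡ q
    at-d = Fin.toℕ-fromℕ< q<n
    other : ∀ i j → i ≢ d → B′ i j ≡ B i j
    other i j i≢d = firstRowsFrom-other q i j (λ i≡q → i≢d (Fin.toℕ-injective (trans i≡q (sym at-d))))
    unchanged-d : RowUnchanged M N d → det B′ ≡ det B
    unchanged-d unchanged = det-cong same
      where
      same : ∀ i j → B′ i j ≡ B i j
      same i j with i Fin.≟ d
      ... | no i≢d   = other i j i≢d
      ... | yes refl = trans (firstRowsFrom-new q i j at-d) (trans (unchanged j) (sym (firstRowsFrom-old q i j at-d)))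
    operate : RowOperation M N d → det B′ ≡ det B
    operate (inj₁ unchanged) = unchanged-d unchanged
    operate (inj₂ (s , k , unchanged , added)) with d Fin.≟ s
    ... | yes refl = unchanged-d unchanged
    ... | no d≢s   = det-add-row-multiple B B′ k d≢s other
      (λ j → trans (firstRowsFrom-new q d j at-d)
                   (trans (added j) (sym (cong₂ (λ a b → a + k * b) (firstRowsFrom-old q d j at-d)
                                                                    (firstRowsFrom-unchanged q s j unchanged)))))

det-add-row-multiples : ∀ {n} (M N : Matrix n) → (∀ i → RowOperation M N i) → det N ≡ det M
det-add-row-multiples {n} M N op = trans (det-cong (λ i j → sym (firstRowsFrom-all M N i j))) (det-first n)
  where
  det-first : ∀ q → det (firstRowsFrom q N M) ≡ det M
  det-first zero    = refl
  det-first (suc q) = trans (det-firstRowsFrom-suc M N op q) (det-first q)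

det-add-column-multiples : ∀ {n} (M N : Matrix n) →
                           (∀ j → RowOperation (λ i j → M j i) (λ i j → N j i) j) → det N ≡ det M
det-add-column-multiples M N op =
  trans (sym (det-transpose N)) (trans (det-add-row-multiples _ _ op) (det-transpose M))

punchIn-↑ʳ : ∀ {p q} (j : Fin (suc p)) (l : Fin q) → punchIn (j ↑ˡ q) (p ↑ʳ l) ≡ suc p ↑ʳ l
punchIn-↑ʳ {p}     zero    l = refl
punchIn-↑ʳ {suc p} (suc j) l = cong suc (punchIn-↑ʳ j l)

punchIn-↑ˡ : ∀ {p q} (j : Fin (suc p)) (l : Fin p) → punchIn (j ↑ˡ q) (l ↑ˡ q) ≡ punchIn j l ↑ˡ q
punchIn-↑ˡ         zero    l       = refl
punchIn-↑ˡ {suc p} (suc j) zero    = refl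
punchIn-↑ˡ {suc p} (suc j) (suc l) = cong suc (punchIn-↑ˡ j l)

det-block-lowerTriangular : ∀ p q (M : Matrix (p ℕ.+ q)) → (∀ i j → M (i ↑ˡ q) (p ↑ʳ j) ≡ + 0) →
                            det M ≡ det (λ i j → M (i ↑ˡ q) (j ↑ˡ q)) * det (λ i j → M (p ↑ʳ i) (p ↑ʳ j))
det-block-lowerTriangular zero    q M zeros = sym (ℤ.*-identityˡ (det M))
det-block-lowerTriangular (suc p) q M zeros = begin
  sumℤ (firstRowTerm M)
    ≡⟨ sum-splitAt (suc p) q (firstRowTerm M) ⟩
  sumℤ (λ j → firstRowTerm M (j ↑ˡ q)) + sumℤ (λ l → firstRowTerm M (suc p ↑ʳ l))
    ≡⟨ cong₂ _+_ (sum-cong left) (sum-zero right) ⟩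
  sumℤ (λ j → firstRowTerm X j * det Z) + + 0
    ≡⟨ ℤ.+-identityʳ _ ⟩
  sumℤ (λ j → firstRowTerm X j * det Z)
    ≡⟨ *-distribʳ-sum (det Z) (firstRowTerm X) ⟩
  det X * det Z ∎
  where
  open ≡-Reasoning
  X = λ i j → M (i ↑ˡ q) (j ↑ˡ q)
  Z = λ i j → M (suc p ↑ʳ i) (suc p ↑ʳ j)
  right : ∀ l → firstRowTerm M (suc p ↑ʳ l) ≡ + 0
  right l = trans (cong (λ a → sign (toℕ (suc p ↑ʳ l)) * a * det (minor M zero (suc p ↑ʳ l))) (zeros zero l))
                  (trans (cong (_* det (minor M zero (suc p ↑ʳ l))) (ℤ.*-zeroʳ (sign (toℕ (suc p ↑ʳ l)))))
                         (ℤ.*-zeroˡ (det (minor M zero (suc p ↑ʳ l)))))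
  left : ∀ j → firstRowTerm M (j ↑ˡ q) ≡ firstRowTerm X j * det Z
  left j = trans (cong₂ (λ a D → sign a * M zero (j ↑ˡ q) * D) (Fin.toℕ-↑ˡ j q) minor-factors)
                 (sym (ℤ.*-assoc (sign (toℕ j) * X zero j) (det (minor X zero j)) (det Z)))
    where
    minor-factors : det (minor M zero (j ↑ˡ q)) ≡ det (minor X zero j) * det Z
    minor-factors =
      trans (det-block-lowerTriangular p q (minor M zero (j ↑ˡ q))
               (λ i l → trans (cong (M (suc (i ↑ˡ q))) (punchIn-↑ʳ j l)) (zeros (suc i) l)))
            (cong₂ _*_ (det-cong (λ i l → cong (M (suc (i ↑ˡ q))) (punchIn-↑ˡ j l)))
                       (det-cong (λ i l → cong (M (suc (p ↑ʳ i))) (punchIn-↑ʳ j l))))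

det-scalar : ∀ n (x : ℤ) → det {n} (λ i j → x * identity i j) ≡ x ^ n
det-scalar zero    x = refl
det-scalar (suc n) x = begin
  det X                                   ≡⟨ det-unit-column X zero zero off ⟩
  + 1 * X zero zero * det (minor X zero zero) ≡⟨ cong₂ (λ a D → + 1 * a * D) diag minor-scalar ⟩
  + 1 * x * x ^ n                          ≡⟨ cong (_* x ^ n) (ℤ.*-identityˡ x) ⟩
  x * x ^ n                                ∎
  where
  open ≡-Reasoning
  X : Matrix (suc n)
  X i j = x * identity i j
  off : ∀ i → i ≢ zero → X i zero ≡ + 0
  off i i≢0 = trans (cong (x *_) (identity-offDiag i≢0)) (ℤ.*-zeroʳ x)
  diag : X zero zero ≡ x
  diag = trans (cong (x *_) (identity-diag {suc n} zero)) (ℤ.*-identityʳ x)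
  minor-scalar : det (minor X zero zero) ≡ x ^ n
  minor-scalar = trans (det-cong {n} (λ i l → cong (x *_) (identity-reindex suc Fin.suc-injective i l))) (det-scalar n x)

det-block-symmetric : ∀ {n} (M : Matrix (n ℕ.+ n)) (P Q : Matrix n) →
                      (∀ i j → M (i ↑ˡ n) (j ↑ˡ n) ≡ P i j) → (∀ i j → M (i ↑ˡ n) (n ↑ʳ j) ≡ Q i j) →
                      (∀ i j → M (n ↑ʳ i) (j ↑ˡ n) ≡ Q i j) → (∀ i j → M (n ↑ʳ i) (n ↑ʳ j) ≡ P i j) →
                      det M ≡ det (λ i j → P i j + Q i j) * det (λ i j → P i j - Q i j)
det-block-symmetric {n} M P Q ll lr rl rr = begin
  det M                                      ≡⟨ sym (det-add-column-multiples M M₁ column-operation) ⟩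
  det M₁                                     ≡⟨ sym (det-add-row-multiples M₁ M₂ row-operation) ⟩
  det M₂                                     ≡⟨ det-block-lowerTriangular n n M₂ upper-right ⟩
  det (λ i j → M₂ (i ↑ˡ n) (j ↑ˡ n)) * det (λ i j → M₂ (n ↑ʳ i) (n ↑ʳ j))
                                             ≡⟨ cong₂ _*_ (det-cong upper-left) (det-cong lower-right) ⟩
  det (λ i j → P i j + Q i j) * det (λ i j → P i j - Q i j) ∎
  where
  open ≡-Reasoning
  M₁ : Matrix (n ℕ.+ n)
  M₁ a b = [ (λ _ → M a b) , (λ j → M a b - M a (j ↑ˡ n)) ]′ (splitAt n b)
  M₂ : Matrix (n ℕ.+ n)
  M₂ a b = [ (λ i → M₁ a b + M₁ (n ↑ʳ i) b) , (λ _ → M₁ a b) ]′ (splitAt n a)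

  M₁-left : ∀ a j → M₁ a (j ↑ˡ n) ≡ M a (j ↑ˡ n)
  M₁-left a j rewrite Fin.splitAt-↑ˡ n j n = refl
  M₁-right : ∀ a j → M₁ a (n ↑ʳ j) ≡ M a (n ↑ʳ j) - M a (j ↑ˡ n)
  M₁-right a j rewrite Fin.splitAt-↑ʳ n n j = refl
  M₂-upper : ∀ i b → M₂ (i ↑ˡ n) b ≡ M₁ (i ↑ˡ n) b + M₁ (n ↑ʳ i) b
  M₂-upper i b rewrite Fin.splitAt-↑ˡ n i n = refl
  M₂-lower : ∀ i b → M₂ (n ↑ʳ i) b ≡ M₁ (n ↑ʳ i) b
  M₂-lower i b rewrite Fin.splitAt-↑ʳ n n i = refl

  minus : ∀ a b → a - b ≡ a + - + 1 * b
  minus = solve-∀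

  column-operation : ∀ b → RowOperation (λ i j → M j i) (λ i j → M₁ j i) b
  column-operation b with splitAt n b
  ... | inj₁ _ = inj₁ (λ a → refl)
  ... | inj₂ j = inj₂ (j ↑ˡ n , - + 1 , (λ a → M₁-left a j) , λ a → minus (M a b) (M a (j ↑ˡ n)))

  row-operation : ∀ a → RowOperation M₁ M₂ a
  row-operation a with splitAt n a
  ... | inj₂ _ = inj₁ (λ b → refl)
  ... | inj₁ i = inj₂ (n ↑ʳ i , + 1 , M₂-lower i , λ b → cong (_+_ (M₁ a b)) (sym (ℤ.*-identityˡ (M₁ (n ↑ʳ i) b))))

  upper-right : ∀ i j → M₂ (i ↑ˡ n) (n ↑ʳ j) ≡ + 0
  upper-right i j =
    trans (M₂-upper i (n ↑ʳ j))
          (trans (cong₂ _+_ (trans (M₁-right (i ↑ˡ n) j) (cong₂ _-_ (lr i j) (ll i j)))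
                            (trans (M₁-right (n ↑ʳ i) j) (cong₂ _-_ (rr i j) (rl i j))))
                 (cancel (Q i j) (P i j)))
    where
    cancel : ∀ q p → (q - p) + (p - q) ≡ + 0
    cancel = solve-∀

  upper-left : ∀ i j → M₂ (i ↑ˡ n) (j ↑ˡ n) ≡ P i j + Q i j
  upper-left i j = trans (M₂-upper i (j ↑ˡ n))
                         (cong₂ _+_ (trans (M₁-left (i ↑ˡ n) j) (ll i j)) (trans (M₁-left (n ↑ʳ i) j) (rl i j)))

  lower-right : ∀ i j → M₂ (n ↑ʳ i) (n ↑ʳ j) ≡ P i j - Q i j
  lower-right i j = trans (M₂-lower i (n ↑ʳ j)) (trans (M₁-right (n ↑ʳ i) j) (cong₂ _-_ (rr i j) (rl i j)))

-- Sylvester's identity for incidence matrices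

Monotone : ∀ {n T} → (Fin n → Fin T) → Set
Monotone = Monotonic₁ Fin._≤_ Fin._≤_

Surjective : ∀ {n T} → (Fin n → Fin T) → Set
Surjective = StrictlySurjective _≡_

monotone-surjective⇒≤ : ∀ {T} (γ : Fin T → Fin T) → Monotone γ → Surjective γ → ∀ i → γ i Fin.≤ i
monotone-surjective⇒≤ {T} γ mono surj i = bound (toℕ i) i refl
  where
  bound : ∀ k (i : Fin T) → toℕ i ≡ k → toℕ (γ i) ℕ.≤ k
  bound zero i i≡0 with surj i
  ... | j , γj≡i = subst (toℕ (γ i) ℕ.≤_) i≡0
                     (subst (λ p → γ i Fin.≤ p) γj≡i (mono (subst (ℕ._≤ toℕ j) (sym i≡0) ℕ.z≤n)))
  bound (suc k) (suc c) 1+c≡1+k with surj (suc c)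
  ... | j , γj≡1+c with toℕ j ℕ.≤? toℕ (Fin.inject₁ c)
  ...   | no j≰c  = subst (toℕ (γ (suc c)) ℕ.≤_) 1+c≡1+k
                      (subst (λ p → γ (suc c) Fin.≤ p) γj≡1+c (mono (ℕ.≰⇒> j≰c′)))
    where
    j≰c′ : toℕ j ℕ.≰ toℕ c
    j≰c′ = j≰c ∘ subst (toℕ j ℕ.≤_) (sym (Fin.toℕ-inject₁ c))
  ...   | yes j≤c = ⊥-elim (ℕ.<-irrefl refl (ℕ.≤-<-trans below (ℕ.n<1+n k)))
    where
    below : suc k ℕ.≤ k
    below = subst (ℕ._≤ k) (trans (cong toℕ γj≡1+c) 1+c≡1+k)
              (ℕ.≤-trans (mono j≤c) (bound k (Fin.inject₁ c) (trans (Fin.toℕ-inject₁ c) (ℕ.suc-injective 1+c≡1+k))))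

opposite-antitone : ∀ {T} {i j : Fin T} → i Fin.≤ j → Fin.opposite j Fin.≤ Fin.opposite i
opposite-antitone {T} {i} {j} i≤j =
  subst₂ ℕ._≤_ (sym (Fin.opposite-prop j)) (sym (Fin.opposite-prop i)) (ℕ.∸-monoʳ-≤ T (ℕ.s≤s i≤j))

-- Reflecting γ through  opposite  turns the upper bound into a lower bound.
monotone-surjective⇒id : ∀ {T} (γ : Fin T → Fin T) → Monotone γ → Surjective γ → ∀ i → γ i ≡ i
monotone-surjective⇒id {T} γ mono surj i =
  Fin.≤-antisym (monotone-surjective⇒≤ γ mono surj i)
    (ℕ.≤-pred (ℕ.∸-cancelʳ-≤ (Fin.toℕ<n i)
      (subst₂ ℕ._≤_ (Fin.opposite-prop (γ i)) (Fin.opposite-prop i)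
        (subst (λ a → Fin.opposite (γ a) Fin.≤ Fin.opposite i) (Fin.opposite-involutive i)
          (monotone-surjective⇒≤ γ′ mono′ surj′ (Fin.opposite i))))))
  where
  γ′ : Fin T → Fin T
  γ′ = Fin.opposite ∘ γ ∘ Fin.opposite
  mono′ : Monotone γ′
  mono′ = opposite-antitone ∘ mono ∘ opposite-antitone
  surj′ : Surjective γ′
  surj′ p with surj (Fin.opposite p)
  ... | j , γj≡p′ = Fin.opposite j
                  , trans (cong (Fin.opposite ∘ γ) (Fin.opposite-involutive j))
                          (trans (cong Fin.opposite γj≡p′) (Fin.opposite-involutive p))

-- xI+FΓ and xI+ΓF are  x·I + F·Γ  and  x·I + Γ·F  for the T × n incidence matrix  Γ p j = [γ j ≡ p].
xI+FΓ : ∀ {n T} → ℤ → (Fin n → Fin T) → (Fin n → Fin T → ℤ) → Matrix n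
xI+FΓ x γ f i j = x * identity i j + f i (γ j)

xI+ΓF : ∀ {n T} → ℤ → (Fin n → Fin T) → (Fin n → Fin T → ℤ) → Matrix T
xI+ΓF x γ f p q = x * identity p q + sumℤ (λ j → identity (γ j) p * f j q)

mergeRow : ∀ {n T} → (Fin (suc n) → Fin T → ℤ) → Fin (suc n) → Fin (suc n) → Fin n → Fin T → ℤ
mergeRow f c d i q = f (punchIn c i) q + identity (punchIn c i) d * f c q

ΓF-mergeRow : ∀ {n T} (γ : Fin (suc n) → Fin T) (f : Fin (suc n) → Fin T → ℤ) {c d} → c ≢ d → γ c ≡ γ d →
              ∀ p q → sumℤ (λ i → identity (γ (punchIn c i)) p * mergeRow f c d i q)
                      ≡ sumℤ (λ j → identity (γ j) p * f j q)
ΓF-mergeRow γ f {c} {d} c≢d γc≡γd p q = begin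
  sumℤ (λ i → g (punchIn c i) * (f (punchIn c i) q + identity (punchIn c i) d * f c q))
    ≡⟨ sum-cong (λ i → ℤ.*-distribˡ-+ (g (punchIn c i)) _ _) ⟩
  sumℤ (λ i → g (punchIn c i) * f (punchIn c i) q + g (punchIn c i) * (identity (punchIn c i) d * f c q))
    ≡⟨ sum-distrib-+ (λ i → g (punchIn c i) * f (punchIn c i) q) _ ⟩
  sumℤ (λ i → g (punchIn c i) * f (punchIn c i) q) + sumℤ (λ i → g (punchIn c i) * (identity (punchIn c i) d * f c q))
    ≡⟨ cong (_+_ (sumℤ (λ i → g (punchIn c i) * f (punchIn c i) q))) moved ⟩
  sumℤ (λ i → g (punchIn c i) * f (punchIn c i) q) + g c * f c q
    ≡⟨ ℤ.+-comm _ (g c * f c q) ⟩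
  g c * f c q + sumℤ (λ i → g (punchIn c i) * f (punchIn c i) q)
    ≡⟨ sum-punchIn c (λ j → g j * f j q) ⟨
  sumℤ (λ j → g j * f j q) ∎
  where
  open ≡-Reasoning
  g : Fin _ → ℤ
  g j = identity (γ j) p
  e = punchOut c≢d
  moved : sumℤ (λ i → g (punchIn c i) * (identity (punchIn c i) d * f c q)) ≡ g c * f c q
  moved = begin
    sumℤ (λ i → g (punchIn c i) * (identity (punchIn c i) d * f c q))
      ≡⟨ sum-cong (λ i → trans (regroup (g (punchIn c i)) (identity (punchIn c i) d) (f c q))
                              (cong (_* (g (punchIn c i) * f c q)) (reindex i))) ⟩
    sumℤ (λ i → identity i e * (g (punchIn c i) * f c q))
      ≡⟨ sum-identity-* e (λ i → g (punchIn c i) * f c q) ⟩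
    g (punchIn c e) * f c q
      ≡⟨ cong (λ a → identity a p * f c q) (trans (cong γ (Fin.punchIn-punchOut c≢d)) (sym γc≡γd)) ⟩
    g c * f c q ∎
    where
    regroup : ∀ a b c → a * (b * c) ≡ b * (a * c)
    regroup = solve-∀
    reindex : ∀ i → identity (punchIn c i) d ≡ identity i e
    reindex i = trans (cong (identity (punchIn c i)) (sym (Fin.punchIn-punchOut c≢d)))
                      (identity-reindex (punchIn c) (Fin.punchIn-injective c _ _) i e)

-- Subtracting column d from column c, then adding row c to row d, leaves x times the unit
-- vector in column c; the remaining minor has the same shape with rows c and d of F merged.
det-xI+FΓ-merge : ∀ {n T} (x : ℤ) (γ : Fin (suc n) → Fin T) (f : Fin (suc n) → Fin T → ℤ) {c d} →
                  c ≢ d → γ c ≡ γ d → det (xI+FΓ x γ f) ≡ x * det (xI+FΓ x (γ ∘ punchIn c) (mergeRow f c d))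
det-xI+FΓ-merge {n} x γ f {c} {d} c≢d γc≡γd = begin
  det M                               ≡⟨ det-add-column-multiple M M₁ (- + 1) c≢d (λ i j → setColumn-≢ M c newColumn i) (setColumn-≡ M c newColumn) ⟨
  det M₁                              ≡⟨ det-add-row-multiple M₁ M₂ (+ 1) (c≢d ∘ sym) (λ i j i≢d → setColumn-≢ M₁ᵀ d newRow j i≢d) (setColumn-≡ M₁ᵀ d newRow) ⟨
  det M₂                              ≡⟨ det-unit-column M₂ c c M₂-column-c ⟩
  sign (toℕ c ℕ.+ toℕ c) * M₂ c c * det (minor M₂ c c)
                                      ≡⟨ cong₂ (λ s a → s * a * det (minor M₂ c c)) (sign-double (toℕ c)) M₂-cc ⟩
  + 1 * x * det (minor M₂ c c)        ≡⟨ cong₂ (λ a D → a * D) (ℤ.*-identityˡ x) (det-cong minor-merged) ⟩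
  x * det (xI+FΓ x (γ ∘ punchIn c) (mergeRow f c d)) ∎
  where
  open ≡-Reasoning
  M = xI+FΓ x γ f
  newColumn : Fin (suc n) → ℤ
  newColumn i = M i c + - + 1 * M i d
  M₁ = setColumn M c newColumn
  M₁ᵀ : Matrix (suc n)
  M₁ᵀ i j = M₁ j i
  newRow : Fin (suc n) → ℤ
  newRow j = M₁ d j + + 1 * M₁ c j
  M₂ : Matrix (suc n)
  M₂ i j = setColumn M₁ᵀ d newRow j i

  column-c : ∀ i → M₁ i c ≡ x * identity i c + - + 1 * (x * identity i d)
  column-c i = trans (setColumn-≡ M c newColumn i)
    (trans (cong (λ a → x * identity i c + f i (γ c) + - + 1 * (x * identity i d + f i a)) (sym γc≡γd))
           (cancel x (identity i c) (identity i d) (f i (γ c))))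
    where
    cancel : ∀ x a b y → x * a + y + - + 1 * (x * b + y) ≡ x * a + - + 1 * (x * b)
    cancel = solve-∀
  M₁-off : ∀ i {j} → j ≢ c → M₁ i j ≡ M i j
  M₁-off i = setColumn-≢ M c newColumn i

  M₂-rows : ∀ a b → M₂ a b ≡ M₁ a b + identity a d * M₁ c b
  M₂-rows a b = by-row (a Fin.≟ d)
    where
    by-row : Dec (a ≡ d) → M₂ a b ≡ M₁ a b + identity a d * M₁ c b
    by-row (yes refl) = trans (setColumn-≡ M₁ᵀ a newRow b)
                              (cong (λ δ → M₁ a b + δ * M₁ c b) (sym (identity-diag a)))
    by-row (no a≢d)   = trans (setColumn-≢ M₁ᵀ d newRow b a≢d)
                              (sym (trans (cong (λ δ → M₁ a b + δ * M₁ c b) (identity-offDiag a≢d))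
                                          (trans (cong (_+_ (M₁ a b)) (ℤ.*-zeroˡ (M₁ c b))) (ℤ.+-identityʳ (M₁ a b)))))

  M₂-cc : M₂ c c ≡ x
  M₂-cc = trans (M₂-rows c c)
    (trans (cong₂ (λ a δ → a + δ * a) (column-c c) (identity-offDiag c≢d))
      (trans (cong₂ (λ u v → x * u + - + 1 * (x * v) + + 0 * (x * u + - + 1 * (x * v))) (identity-diag c) (identity-offDiag c≢d))
             (simplify x)))
    where
    simplify : ∀ x → x * + 1 + - + 1 * (x * + 0) + + 0 * (x * + 1 + - + 1 * (x * + 0)) ≡ x
    simplify = solve-∀

  M₂-column-c : ∀ i → i ≢ c → M₂ i c ≡ + 0
  M₂-column-c i i≢c = trans (M₂-rows i c)
    (trans (cong₂ (λ a b → a + identity i d * b) (column-c i) (column-c c))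
      (trans (cong₃ (λ u v w → x * u + - + 1 * (x * identity i d) + identity i d * (x * v + - + 1 * (x * w)))
                    (identity-offDiag i≢c) (identity-diag c) (identity-offDiag c≢d))
             (cancel x (identity i d))))
    where
    cancel : ∀ x δ → x * + 0 + - + 1 * (x * δ) + δ * (x * + 1 + - + 1 * (x * + 0)) ≡ + 0
    cancel = solve-∀
    cong₃ : ∀ (h : ℤ → ℤ → ℤ → ℤ) {u u′ v v′ w w′} → u ≡ u′ → v ≡ v′ → w ≡ w′ → h u v w ≡ h u′ v′ w′
    cong₃ h refl refl refl = refl

  minor-merged : ∀ i l → minor M₂ c c i l ≡ xI+FΓ x (γ ∘ punchIn c) (mergeRow f c d) i l
  minor-merged i l = trans (M₂-rows a b)
    (trans (cong₂ (λ u v → u + identity a d * v) (M₁-off a b≢c) (M₁-off c b≢c))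
      (trans (cong₂ (λ u v → x * u + f a (γ b) + identity a d * (x * v + f c (γ b)))
                    (identity-reindex (punchIn c) (Fin.punchIn-injective c _ _) i l) (identity-offDiag (b≢c ∘ sym)))
             (regroup x (identity i l) (f a (γ b)) (identity a d) (f c (γ b)))))
    where
    a = punchIn c i
    b = punchIn c l
    b≢c : b ≢ c
    b≢c = Fin.punchInᵢ≢i c l
    regroup : ∀ x δ u δ′ v → x * δ + u + δ′ * (x * + 0 + v) ≡ x * δ + (u + δ′ * v)
    regroup = solve-∀

-- Repeatedly merging two rows of F with the same γ-value brings n down to T; a monotone
-- surjection Fin T → Fin T is then the identity, and  x·I + F·Γ  is literally  x·I + Γ·F.
det-xI+FΓ : ∀ e {n T} → n ≡ e ℕ.+ T → (γ : Fin n → Fin T) → Monotone γ → Surjective γ →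
            ∀ x f → det (xI+FΓ x γ f) ≡ x ^ e * det (xI+ΓF x γ f)
det-xI+FΓ zero refl γ mono surj x f = trans (det-cong same) (sym (ℤ.*-identityˡ _))
  where
  γ≡id = monotone-surjective⇒id γ mono surj
  same : ∀ i j → xI+FΓ x γ f i j ≡ xI+ΓF x γ f i j
  same i j = cong (_+_ (x * identity i j))
    (trans (cong (f i) (γ≡id j))
           (sym (trans (sum-cong (λ k → cong (λ a → identity a i * f k j) (γ≡id k))) (sum-identity-* i (λ k → f k j)))))
det-xI+FΓ (suc e) {T = T} refl γ mono surj x f
  with c , d , c<d , γc≡γd ← Fin.pigeonhole (ℕ.s≤s (ℕ.m≤n+m T e)) γ = begin
  det (xI+FΓ x γ f)
    ≡⟨ det-xI+FΓ-merge x γ f c≢d γc≡γd ⟩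
  x * det (xI+FΓ x (γ ∘ punchIn c) (mergeRow f c d))
    ≡⟨ cong (x *_) (det-xI+FΓ e refl (γ ∘ punchIn c) mono′ surj′ x (mergeRow f c d)) ⟩
  x * (x ^ e * det (xI+ΓF x (γ ∘ punchIn c) (mergeRow f c d)))
    ≡⟨ cong (λ D → x * (x ^ e * D)) (det-cong (λ p q → cong (_+_ (x * identity p q)) (ΓF-mergeRow γ f c≢d γc≡γd p q))) ⟩
  x * (x ^ e * det (xI+ΓF x γ f))
    ≡⟨ ℤ.*-assoc x (x ^ e) _ ⟨
  x * x ^ e * det (xI+ΓF x γ f) ∎
  where
  open ≡-Reasoning
  c≢d : c ≢ d
  c≢d c≡d = ℕ.<-irrefl (cong toℕ c≡d) c<d
  mono′ : Monotone (γ ∘ punchIn c)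
  mono′ {i} {j} i≤j = mono (Fin.punchIn-mono-≤ c i j i≤j)
  surj′ : Surjective (γ ∘ punchIn c)
  surj′ p with surj p
  ... | j , γj≡p with c Fin.≟ j
  ...   | no c≢j    = punchOut c≢j , trans (cong γ (Fin.punchIn-punchOut c≢j)) γj≡p
  ...   | yes refl  = punchOut c≢d , trans (cong γ (Fin.punchIn-punchOut c≢d)) (trans (sym γc≡γd) γj≡p)

det-aI+bJ : ∀ e (a b : ℤ) → det {suc e} (λ i j → a * identity i j + b) ≡ a ^ e * (a + + suc e * b)
det-aI+bJ e a b = begin
  det (xI+FΓ a γ (λ _ _ → b))
    ≡⟨ det-xI+FΓ e (ℕ.+-comm 1 e) γ (λ _ → ℕ.z≤n) (λ { zero → zero , refl }) a (λ _ _ → b) ⟩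
  a ^ e * det (xI+ΓF a γ (λ _ _ → b))
    ≡⟨ cong (a ^ e *_) (det1 (xI+ΓF a γ (λ _ _ → b))) ⟩
  a ^ e * (a * + 1 + sumℤ {suc e} (λ _ → + 1 * b))
    ≡⟨ cong (λ s → a ^ e * (a * + 1 + s)) (trans (sum-cong {suc e} (λ _ → ℤ.*-identityˡ b)) (sum-const (suc e) b)) ⟩
  a ^ e * (a * + 1 + + suc e * b)
    ≡⟨ cong (λ u → a ^ e * (u + + suc e * b)) (ℤ.*-identityʳ a) ⟩
  a ^ e * (a + + suc e * b) ∎
  where
  open ≡-Reasoning
  γ : Fin (suc e) → Fin 1
  γ _ = zero
  det1 : ∀ (N : Matrix 1) → det N ≡ N zero zero
  det1 N = lemma (N zero zero)
    where
    lemma : ∀ v → + 1 * v * + 1 + + 0 ≡ v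
    lemma = solve-∀

quotient-↑ˡ : ∀ {k} m (i : Fin m) → quotient {suc k} m (i ↑ˡ (k ℕ.* m)) ≡ zero
quotient-↑ˡ {k} m i rewrite Fin.splitAt-↑ˡ m i (k ℕ.* m) = refl

quotient-↑ʳ : ∀ {k} m (j : Fin (k ℕ.* m)) → quotient {suc k} m (m ↑ʳ j) ≡ suc (quotient {k} m j)
quotient-↑ʳ {k} m j rewrite Fin.splitAt-↑ʳ m (k ℕ.* m) j = refl

↑ˡ-or-↑ʳ : ∀ m n (i : Fin (m ℕ.+ n)) → (∃ λ i′ → i ≡ i′ ↑ˡ n) ⊎ (∃ λ i′ → i ≡ m ↑ʳ i′)
↑ˡ-or-↑ʳ m n i with splitAt m i in eq
... | inj₁ i′ = inj₁ (i′ , sym (Fin.splitAt⁻¹-↑ˡ eq))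
... | inj₂ i′ = inj₂ (i′ , sym (Fin.splitAt⁻¹-↑ʳ eq))

quotient-monotone : ∀ k m → Monotone (quotient {k} m)
quotient-monotone (suc k) m {i} {j} i≤j with ↑ˡ-or-↑ʳ m (k ℕ.* m) i | ↑ˡ-or-↑ʳ m (k ℕ.* m) j
... | inj₁ (i′ , refl) | _ rewrite quotient-↑ˡ {k} m i′ = ℕ.z≤n
... | inj₂ (i′ , refl) | inj₁ (j′ , refl) =
  ⊥-elim (ℕ.<-irrefl refl (ℕ.<-≤-trans (subst (ℕ._< m) (sym (Fin.toℕ-↑ˡ j′ (k ℕ.* m))) (Fin.toℕ<n j′))
                                        (ℕ.≤-trans (ℕ.m≤m+n m (toℕ i′)) (subst (ℕ._≤ toℕ (j′ ↑ˡ (k ℕ.* m))) (Fin.toℕ-↑ʳ m i′) i≤j))))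
... | inj₂ (i′ , refl) | inj₂ (j′ , refl) rewrite quotient-↑ʳ {k} m i′ | quotient-↑ʳ {k} m j′ =
  ℕ.s≤s (quotient-monotone k m (ℕ.+-cancelˡ-≤ m (toℕ i′) (toℕ j′) (subst₂ ℕ._≤_ (Fin.toℕ-↑ʳ m i′) (Fin.toℕ-↑ʳ m j′) i≤j)))

quotient-surjective : ∀ k m → Surjective (quotient {k} (suc m))
quotient-surjective k m p = Fin.combine p zero , cong proj₁ (Fin.remQuot-combine p zero)

sum-identity-quotient : ∀ k m (p : Fin k) (v : ℤ) → sumℤ {k ℕ.* m} (λ j → identity (quotient {k} m j) p * v) ≡ + m * v
sum-identity-quotient (suc k) m p v = begin
  sumℤ (λ j → identity (quotient {suc k} m j) p * v)
    ≡⟨ sum-splitAt m (k ℕ.* m) (λ j → identity (quotient {suc k} m j) p * v) ⟩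
  sumℤ (λ i → identity (quotient {suc k} m (i ↑ˡ (k ℕ.* m))) p * v) + sumℤ (λ j → identity (quotient {suc k} m (m ↑ʳ j)) p * v)
    ≡⟨ cong₂ _+_ (sum-cong (λ i → cong (λ a → identity a p * v) (quotient-↑ˡ m i)))
                 (sum-cong (λ j → cong (λ a → identity a p * v) (quotient-↑ʳ m j))) ⟩
  sumℤ {m} (λ _ → identity zero p * v) + sumℤ (λ j → identity (suc (quotient {k} m j)) p * v)
    ≡⟨ by-part p ⟩
  + m * v ∎
  where
  open ≡-Reasoning
  by-part : ∀ p → sumℤ {m} (λ _ → identity zero p * v) + sumℤ (λ j → identity (suc (quotient {k} m j)) p * v) ≡ + m * v
  by-part zero = trans (cong₂ _+_ (trans (sum-cong {m} (λ _ → cong (_* v) (identity-diag {suc k} zero)))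
                                         (trans (sum-cong {m} (λ _ → ℤ.*-identityˡ v)) (sum-const m v)))
                                  (sum-zero (λ j → trans (cong (_* v) (identity-offDiag {i = suc (quotient {k} m j)} {zero} λ ())) (ℤ.*-zeroˡ v))))
                       (ℤ.+-identityʳ (+ m * v))
  by-part (suc p) = trans (cong₂ _+_ (sum-zero {m} (λ _ → trans (cong (_* v) (identity-offDiag {i = zero} {suc p} λ ())) (ℤ.*-zeroˡ v)))
                                     (trans (sum-cong (λ j → cong (_* v) (identity-reindex suc Fin.suc-injective (quotient {k} m j) p)))
                                            (sum-identity-quotient k m p v)))
                          (ℤ.+-identityˡ (+ m * v))

diffParts≡1-identity : ∀ k m (i j : Fin (k ℕ.* m)) →
                       + diffParts k m i j ≡ + 1 - identity (quotient {k} m i) (quotient {k} m j)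
diffParts≡1-identity k m i j with quotient {k} m i Fin.≟ quotient {k} m j
... | yes _ = refl
... | no _  = refl

det-multipartite : ∀ k′ m′ (x z : ℤ) → let k = suc k′; m = suc m′ in
                   det {k ℕ.* m} (λ i j → x * identity i j + z * + diffParts k m i j)
                   ≡ x ^ (k ℕ.* m ℕ.∸ k) * ((x - + m * z) ^ k′ * (x - + m * z + + k * (+ m * z)))
det-multipartite k′ m′ x z = begin
  det (λ i j → x * identity i j + z * + diffParts k m i j)
    ≡⟨ det-cong (λ i j → cong (λ a → x * identity i j + z * a) (diffParts≡1-identity k m i j)) ⟩
  det (xI+FΓ x γ f)
    ≡⟨ det-xI+FΓ (k ℕ.* m ℕ.∸ k) (sym (ℕ.m∸n+n≡m (ℕ.m≤m*n k m))) γ (quotient-monotone k m) (quotient-surjective k m′) x f ⟩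
  x ^ (k ℕ.* m ℕ.∸ k) * det (xI+ΓF x γ f)
    ≡⟨ cong (x ^ (k ℕ.* m ℕ.∸ k) *_) (trans (det-cong core) (det-aI+bJ k′ (x - + m * z) (+ m * z))) ⟩
  x ^ (k ℕ.* m ℕ.∸ k) * ((x - + m * z) ^ k′ * (x - + m * z + + k * (+ m * z))) ∎
  where
  open ≡-Reasoning
  k = suc k′
  m = suc m′
  γ = quotient {k} m
  f : Fin (k ℕ.* m) → Fin k → ℤ
  f i q = z * (+ 1 - identity (γ i) q)
  core : ∀ p q → xI+ΓF x γ f p q ≡ (x - + m * z) * identity p q + + m * z
  core p q = trans (cong (_+_ (x * identity p q))
                     (trans (sum-cong (λ j → identity-*-transport (γ j) p (λ a → z * (+ 1 - identity a q))))
                            (sum-identity-quotient k m p (z * (+ 1 - identity p q)))))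
                   (regroup x (identity p q) (+ m) z)
    where
    regroup : ∀ x δ m z → x * δ + m * (z * (+ 1 - δ)) ≡ (x - m * z) * δ + m * z
    regroup = solve-∀

module _ {n} (G : MixedGraph n) (t : ℤ) where

  private
    N : Matrix (n ℕ.+ n)
    N a b = t * identity a b - integratedLap G a b

    if-identity : ∀ (i j : Fin n) D → (if ⌊ i Fin.≟ j ⌋ then + D else + 0) ≡ + D * identity i j
    if-identity i j D with i Fin.≟ j
    ... | yes _ = sym (ℤ.*-identityʳ (+ D))
    ... | no _  = sym (ℤ.*-zeroʳ (+ D))

    ↑ˡ≢↑ʳ : ∀ (i j : Fin n) → i ↑ˡ n ≢ n ↑ʳ j
    ↑ˡ≢↑ʳ i j eq = ℕ.<-irrefl refl (ℕ.<-≤-trans (subst (ℕ._< n) (sym (Fin.toℕ-↑ˡ i n)) (Fin.toℕ<n i))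
                                                (subst (n ℕ.≤_) (sym (trans (cong toℕ eq) (Fin.toℕ-↑ʳ n j))) (ℕ.m≤m+n n (toℕ j))))

    off-diagonal-block : ∀ {a b : Fin (n ℕ.+ n)} (L : ℤ) → a ≢ b → t * identity a b - (+ 0 - L) ≡ L
    off-diagonal-block L a≢b = trans (cong (λ δ → t * δ - (+ 0 - L)) (identity-offDiag a≢b)) (simplify t L)
      where
      simplify : ∀ t L → t * + 0 - (+ 0 - L) ≡ L
      simplify = solve-∀

    diagonal-block : ∀ (i j : Fin n) D (E : ℕ) → t * identity i j - (+ D * identity i j - + E) ≡ (t - + D) * identity i j + + E
    diagonal-block i j D E = regroup t (identity i j) (+ D) (+ E)
      where
      regroup : ∀ t δ D E → t * δ - (D * δ - E) ≡ (t - D) * δ + E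
      regroup = solve-∀

    N-ll : ∀ i j → N (i ↑ˡ n) (j ↑ˡ n) ≡ (t - + (deg G i ℕ.+ outdeg G i)) * identity i j + + edgeEntry G i j
    N-ll i j rewrite Fin.splitAt-↑ˡ n i n | Fin.splitAt-↑ˡ n j n | if-identity i j (deg G i ℕ.+ outdeg G i)
      | identity-reindex (_↑ˡ n) (Fin.↑ˡ-injective n _ _) i j = diagonal-block i j _ _

    N-rr : ∀ i j → N (n ↑ʳ i) (n ↑ʳ j) ≡ (t - + (deg G i ℕ.+ indeg G i)) * identity i j + + edgeEntry G i j
    N-rr i j rewrite Fin.splitAt-↑ʳ n n i | Fin.splitAt-↑ʳ n n j | if-identity i j (deg G i ℕ.+ indeg G i)
      | identity-reindex (n ↑ʳ_) (Fin.↑ʳ-injective n _ _) i j = diagonal-block i j _ _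

    N-lr : ∀ i j → N (i ↑ˡ n) (n ↑ʳ j) ≡ + arcs G i j
    N-lr i j rewrite Fin.splitAt-↑ˡ n i n | Fin.splitAt-↑ʳ n n j = off-diagonal-block _ (↑ˡ≢↑ʳ i j)

    N-rl : ∀ i j → N (n ↑ʳ i) (j ↑ˡ n) ≡ + arcs G j i
    N-rl i j rewrite Fin.splitAt-↑ʳ n n i | Fin.splitAt-↑ˡ n j n = off-diagonal-block _ (↑ˡ≢↑ʳ j i ∘ sym)

  charPoly-integratedLap-balanced : ∀ D → (∀ i → deg G i ℕ.+ outdeg G i ≡ D) → (∀ i → deg G i ℕ.+ indeg G i ≡ D) →
    (∀ i j → arcs G i j ≡ arcs G j i) →
    charPoly (integratedLap G) t ≡ det (λ i j → (t - + D) * identity i j + + edgeEntry G i j + + arcs G i j)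
                                 * det (λ i j → (t - + D) * identity i j + + edgeEntry G i j - + arcs G i j)
  charPoly-integratedLap-balanced D out-deg in-deg arcs-sym =
    det-block-symmetric N P Q
      (λ i j → trans (N-ll i j) (cong (λ d → (t - + d) * identity i j + + edgeEntry G i j) (out-deg i)))
      N-lr
      (λ i j → trans (N-rl i j) (cong +_ (arcs-sym j i)))
      (λ i j → trans (N-rr i j) (cong (λ d → (t - + d) * identity i j + + edgeEntry G i j) (in-deg i)))
    where
    P Q : Matrix n
    P i j = (t - + D) * identity i j + + edgeEntry G i j
    Q i j = + arcs G i j

+-∸ : ∀ {a b} → b ≤ a → + (a ∸ b) ≡ + a - + b
+-∸ {a} {b} b≤a = trans (sym (ℤ.⊖-≥ b≤a)) (sym (ℤ.m-n≡m⊖n a b))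

sumℕ-diffParts : ∀ k′ m (i : Fin (suc k′ ℕ.* m)) → let k = suc k′ in sumℕ (diffParts k m i) ≡ k ℕ.* m ∸ m
sumℕ-diffParts k′ m i = ℤ.+-injective (begin
  + sumℕ (diffParts k m i)                          ≡⟨ +-sumℕ (diffParts k m i) ⟩
  sumℤ (λ u → + diffParts k m i u)                  ≡⟨ sum-cong as-indicator ⟩
  sumℤ (λ u → + 1 + - + 1 * same u)                 ≡⟨ sum-distrib-+ (λ _ → + 1) (λ u → - + 1 * same u) ⟩
  sumℤ {k ℕ.* m} (λ _ → + 1) + sumℤ (λ u → - + 1 * same u)
                                                    ≡⟨ cong₂ _+_ (sum-const (k ℕ.* m) (+ 1))
                                                         (trans (*-distribˡ-sum (- + 1) same)
                                                                (cong (- + 1 *_) (sum-identity-quotient k m (quotient {k} m i) (+ 1)))) ⟩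
  + (k ℕ.* m) * + 1 + - + 1 * (+ m * + 1)           ≡⟨ simplify (+ (k ℕ.* m)) (+ m) ⟩
  + (k ℕ.* m) - + m                                 ≡⟨ +-∸ (ℕ.m≤n*m m k) ⟨
  + (k ℕ.* m ∸ m)                                   ∎)
  where
  open ≡-Reasoning
  k = suc k′
  same : Fin (k ℕ.* m) → ℤ
  same u = identity (quotient {k} m u) (quotient {k} m i) * + 1
  simplify : ∀ a b → a * + 1 + - + 1 * (b * + 1) ≡ a - b
  simplify = solve-∀
  as-indicator : ∀ u → + diffParts k m i u ≡ + 1 + - + 1 * same u
  as-indicator u = trans (cong +_ (diffParts-sym k m i u))
                         (trans (diffParts≡1-identity k m u i) (rewrite-minus (identity (quotient {k} m u) (quotient {k} m i))))
    where
    rewrite-minus : ∀ δ → + 1 - δ ≡ + 1 + - + 1 * (δ * + 1)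
    rewrite-minus = solve-∀

edgeEntry-KM : ∀ k m (i j : Fin (k ℕ.* m)) → edgeEntry (KM k m) i j ≡ diffParts k m i j
edgeEntry-KM k m i j with i Fin.≟ j
... | yes refl = trans (cong (2 ℕ.*_) (same-part i)) (sym (same-part i))
  where
  same-part : ∀ i → diffParts k m i i ≡ 0
  same-part i with quotient {k} m i Fin.≟ quotient {k} m i
  ... | yes _ = refl
  ... | no q≢q = ⊥-elim (q≢q refl)
... | no _ = refl

edgeEntry-KD : ∀ k m (i j : Fin (k ℕ.* m)) → edgeEntry (KD k m) i j ≡ 0
edgeEntry-KD k m i j with i Fin.≟ j
... | yes refl = refl
... | no _     = refl

indeg-diffParts : ∀ k′ m (i : Fin (suc k′ ℕ.* m)) → let k = suc k′ in sumℕ (λ u → diffParts k m u i) ≡ k ℕ.* m ∸ m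
indeg-diffParts k′ m i = trans (sumℕ-cong (λ u → diffParts-sym (suc k′) m u i)) (sumℕ-diffParts k′ m i)

spectrum-KM : ∀ k′ m′ (t : ℤ) → let k = suc k′; m = suc m′ in
  charPoly (integratedLap (KM k m)) t
  ≡ (t - + 0) ^ 1 * (t - + (2 ℕ.* m ℕ.* k)) ^ (k ∸ 1) * (t - + (2 ℕ.* m ℕ.* k ∸ 2 ℕ.* m)) ^ (2 ℕ.* m ℕ.* k ∸ k)
spectrum-KM k′ m′ t = begin
  charPoly (integratedLap (KM k m)) t
    ≡⟨ charPoly-integratedLap-balanced (KM k m) t D (λ i → cong₂ ℕ._+_ (deg-KM i) (sumℕ-diffParts k′ m i))
                                                  (λ i → cong₂ ℕ._+_ (deg-KM i) (indeg-diffParts k′ m i)) (diffParts-sym k m) ⟩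
  det (λ i j → x * identity i j + + edgeEntry (KM k m) i j + + diffParts k m i j)
    * det (λ i j → x * identity i j + + edgeEntry (KM k m) i j - + diffParts k m i j)
    ≡⟨ cong₂ _*_ (trans (det-cong doubled) (det-multipartite k′ m′ x (+ 2)))
                 (trans (det-cong cancelled) (det-scalar (k ℕ.* m) x)) ⟩
  x ^ (k ℕ.* m ∸ k) * ((x - M * + 2) ^ k′ * (x - M * + 2 + K * (M * + 2))) * x ^ (k ℕ.* m)
    ≡⟨ regroup (x ^ (k ℕ.* m ∸ k)) (x ^ (k ℕ.* m)) ((x - M * + 2) ^ k′) (x - M * + 2 + K * (M * + 2)) ⟩
  (x - M * + 2 + K * (M * + 2)) ^ 1 * (x - M * + 2) ^ k′ * (x ^ (k ℕ.* m ∸ k) * x ^ (k ℕ.* m))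
    ≡⟨ cong₂ (λ a b → a ^ 1 * b ^ k′ * (x ^ (k ℕ.* m ∸ k) * x ^ (k ℕ.* m))) eigenvalue-0 eigenvalue-2mk ⟩
  (t - + 0) ^ 1 * (t - + (2 ℕ.* m ℕ.* k)) ^ k′ * (x ^ (k ℕ.* m ∸ k) * x ^ (k ℕ.* m))
    ≡⟨ cong (λ p → (t - + 0) ^ 1 * (t - + (2 ℕ.* m ℕ.* k)) ^ k′ * p) (sym (ℤ.^-distribˡ-+-* x (k ℕ.* m ∸ k) (k ℕ.* m))) ⟩
  (t - + 0) ^ 1 * (t - + (2 ℕ.* m ℕ.* k)) ^ k′ * x ^ (k ℕ.* m ∸ k ℕ.+ k ℕ.* m)
    ≡⟨ cong₂ (λ a e → (t - + 0) ^ 1 * (t - + (2 ℕ.* m ℕ.* k)) ^ k′ * a ^ e) eigenvalue-2mk-2m multiplicity ⟩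
  (t - + 0) ^ 1 * (t - + (2 ℕ.* m ℕ.* k)) ^ k′ * (t - + (2 ℕ.* m ℕ.* k ∸ 2 ℕ.* m)) ^ (2 ℕ.* m ℕ.* k ∸ k) ∎
  where
  open ≡-Reasoning
  k = suc k′
  m = suc m′
  K = + k
  M = + m
  D = (k ℕ.* m ∸ m) ℕ.+ (k ℕ.* m ∸ m)
  x = t - + D
  deg-KM : ∀ i → deg (KM k m) i ≡ k ℕ.* m ∸ m
  deg-KM i = trans (sumℕ-cong (edgeEntry-KM k m i)) (sumℕ-diffParts k′ m i)
  doubled : ∀ i j → x * identity i j + + edgeEntry (KM k m) i j + + diffParts k m i j ≡ x * identity i j + + 2 * + diffParts k m i j
  doubled i j = trans (cong (λ e → x * identity i j + + e + + diffParts k m i j) (edgeEntry-KM k m i j)) (twice (x * identity i j) (+ diffParts k m i j))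
    where
    twice : ∀ a d → a + d + d ≡ a + + 2 * d
    twice = solve-∀
  cancelled : ∀ i j → x * identity i j + + edgeEntry (KM k m) i j - + diffParts k m i j ≡ x * identity i j
  cancelled i j = trans (cong (λ e → x * identity i j + + e - + diffParts k m i j) (edgeEntry-KM k m i j)) (cancel (x * identity i j) (+ diffParts k m i j))
    where
    cancel : ∀ a d → a + d - d ≡ a
    cancel = solve-∀
  regroup : ∀ X Y A B → X * (A * B) * Y ≡ B * + 1 * A * (X * Y)
  regroup = solve-∀
  D≡ : + D ≡ (K * M - M) + (K * M - M)
  D≡ = trans (ℤ.pos-+ (k ℕ.* m ∸ m) (k ℕ.* m ∸ m)) (cong (λ a → a + a) (trans (+-∸ (ℕ.m≤n*m m k)) (cong (_- M) (ℤ.pos-* k m))))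
  2mk≡ : + (2 ℕ.* m ℕ.* k) ≡ + 2 * M * K
  2mk≡ = trans (ℤ.pos-* (2 ℕ.* m) k) (cong (_* K) (ℤ.pos-* 2 m))
  eigenvalue-0 : x - M * + 2 + K * (M * + 2) ≡ t - + 0
  eigenvalue-0 = trans (cong (λ d → t - d - M * + 2 + K * (M * + 2)) D≡) (ring t K M)
    where
    ring : ∀ t K M → t - ((K * M - M) + (K * M - M)) - M * + 2 + K * (M * + 2) ≡ t - + 0
    ring = solve-∀
  eigenvalue-2mk : x - M * + 2 ≡ t - + (2 ℕ.* m ℕ.* k)
  eigenvalue-2mk = trans (cong (λ d → t - d - M * + 2) D≡) (trans (ring t K M) (cong (_-_ t) (sym 2mk≡)))
    where
    ring : ∀ t K M → t - ((K * M - M) + (K * M - M)) - M * + 2 ≡ t - + 2 * M * K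
    ring = solve-∀
  eigenvalue-2mk-2m : x ≡ t - + (2 ℕ.* m ℕ.* k ∸ 2 ℕ.* m)
  eigenvalue-2mk-2m = trans (cong (_-_ t) D≡)
    (trans (ring t K M) (cong (_-_ t) (sym (trans (+-∸ (ℕ.m≤m*n (2 ℕ.* m) k)) (cong₂ _-_ 2mk≡ (ℤ.pos-* 2 m))))))
    where
    ring : ∀ t K M → t - ((K * M - M) + (K * M - M)) ≡ t - (+ 2 * M * K - + 2 * M)
    ring = solve-∀
  multiplicity : k ℕ.* m ∸ k ℕ.+ k ℕ.* m ≡ 2 ℕ.* m ℕ.* k ∸ k
  multiplicity = trans (sym (ℕ.+-∸-comm (k ℕ.* m) (ℕ.m≤m*n k m))) (cong (_∸ k) (double m k))
    where
    double : ∀ m k → k ℕ.* m ℕ.+ k ℕ.* m ≡ 2 ℕ.* m ℕ.* k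
    double = ℕ-Solver.solve-∀

spectrum-KD : ∀ k′ m′ (t : ℤ) → let k = suc k′; m = suc m′ in
  charPoly (integratedLap (KD k m)) t
  ≡ (t - + (2 ℕ.* m ℕ.* k ∸ 2 ℕ.* m)) ^ 1 * (t - + 0) ^ 1 * (t - + (m ℕ.* k)) ^ (k ∸ 1)
    * (t - (+ (m ℕ.* k) - + (2 ℕ.* m))) ^ (k ∸ 1) * (t - + (m ℕ.* k ∸ m)) ^ (2 ℕ.* k ℕ.* m ∸ 2 ℕ.* k)
spectrum-KD k′ m′ t = begin
  charPoly (integratedLap (KD k m)) t
    ≡⟨ charPoly-integratedLap-balanced (KD k m) t D (λ i → cong₂ ℕ._+_ (deg-KD i) (sumℕ-diffParts k′ m i))
                                                  (λ i → cong₂ ℕ._+_ (deg-KD i) (indeg-diffParts k′ m i)) (diffParts-sym k m) ⟩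
  det (λ i j → x * identity i j + + edgeEntry (KD k m) i j + + diffParts k m i j)
    * det (λ i j → x * identity i j + + edgeEntry (KD k m) i j - + diffParts k m i j)
    ≡⟨ cong₂ _*_ (trans (det-cong plus-adjacency) (det-multipartite k′ m′ x (+ 1)))
                 (trans (det-cong minus-adjacency) (det-multipartite k′ m′ x (- + 1))) ⟩
  x ^ e * ((x - M * + 1) ^ k′ * (x - M * + 1 + K * (M * + 1)))
    * (x ^ e * ((x - M * - + 1) ^ k′ * (x - M * - + 1 + K * (M * - + 1))))
    ≡⟨ regroup (x ^ e) ((x - M * + 1) ^ k′) (x - M * + 1 + K * (M * + 1)) ((x - M * - + 1) ^ k′) (x - M * - + 1 + K * (M * - + 1)) ⟩
  (x - M * - + 1 + K * (M * - + 1)) ^ 1 * (x - M * + 1 + K * (M * + 1)) ^ 1 * (x - M * + 1) ^ k′ * (x - M * - + 1) ^ k′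
    * (x ^ e * x ^ e)
    ≡⟨ cong₂ (λ a b → a ^ 1 * b ^ 1 * (x - M * + 1) ^ k′ * (x - M * - + 1) ^ k′ * (x ^ e * x ^ e))
             eigenvalue-2mk-2m eigenvalue-0 ⟩
  (t - + (2 ℕ.* m ℕ.* k ∸ 2 ℕ.* m)) ^ 1 * (t - + 0) ^ 1 * (x - M * + 1) ^ k′ * (x - M * - + 1) ^ k′
    * (x ^ e * x ^ e)
    ≡⟨ cong₂ (λ a b → (t - + (2 ℕ.* m ℕ.* k ∸ 2 ℕ.* m)) ^ 1 * (t - + 0) ^ 1 * a ^ k′ * b ^ k′ * (x ^ e * x ^ e))
             eigenvalue-mk eigenvalue-mk-2m ⟩
  (t - + (2 ℕ.* m ℕ.* k ∸ 2 ℕ.* m)) ^ 1 * (t - + 0) ^ 1 * (t - + (m ℕ.* k)) ^ k′ * (t - (+ (m ℕ.* k) - + (2 ℕ.* m))) ^ k′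
    * (x ^ e * x ^ e)
    ≡⟨ cong (λ p → (t - + (2 ℕ.* m ℕ.* k ∸ 2 ℕ.* m)) ^ 1 * (t - + 0) ^ 1 * (t - + (m ℕ.* k)) ^ k′
                   * (t - (+ (m ℕ.* k) - + (2 ℕ.* m))) ^ k′ * p)
            (trans (sym (ℤ.^-distribˡ-+-* x e e)) (cong₂ _^_ eigenvalue-mk-m multiplicity)) ⟩
  (t - + (2 ℕ.* m ℕ.* k ∸ 2 ℕ.* m)) ^ 1 * (t - + 0) ^ 1 * (t - + (m ℕ.* k)) ^ k′ * (t - (+ (m ℕ.* k) - + (2 ℕ.* m))) ^ k′
    * (t - + (m ℕ.* k ∸ m)) ^ (2 ℕ.* k ℕ.* m ∸ 2 ℕ.* k) ∎
  where
  open ≡-Reasoning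
  k = suc k′
  m = suc m′
  K = + k
  M = + m
  D = k ℕ.* m ∸ m
  x = t - + D
  e = k ℕ.* m ∸ k
  deg-KD : ∀ i → deg (KD k m) i ≡ 0
  deg-KD i = sumℕ-zero (edgeEntry-KD k m i)
  plus-adjacency : ∀ i j → x * identity i j + + edgeEntry (KD k m) i j + + diffParts k m i j
                           ≡ x * identity i j + + 1 * + diffParts k m i j
  plus-adjacency i j = trans (cong (λ a → x * identity i j + + a + + diffParts k m i j) (edgeEntry-KD k m i j))
                             (ring (x * identity i j) (+ diffParts k m i j))
    where
    ring : ∀ a d → a + + 0 + d ≡ a + + 1 * d
    ring = solve-∀
  minus-adjacency : ∀ i j → x * identity i j + + edgeEntry (KD k m) i j - + diffParts k m i j
                            ≡ x * identity i j + - + 1 * + diffParts k m i j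
  minus-adjacency i j = trans (cong (λ a → x * identity i j + + a - + diffParts k m i j) (edgeEntry-KD k m i j))
                              (ring (x * identity i j) (+ diffParts k m i j))
    where
    ring : ∀ a d → a + + 0 - d ≡ a + - + 1 * d
    ring = solve-∀
  regroup : ∀ X A₁ B₁ A₂ B₂ → X * (A₁ * B₁) * (X * (A₂ * B₂)) ≡ B₂ * + 1 * (B₁ * + 1) * A₁ * A₂ * (X * X)
  regroup = solve-∀
  D≡ : + D ≡ K * M - M
  D≡ = trans (+-∸ (ℕ.m≤n*m m k)) (cong (_- M) (ℤ.pos-* k m))
  mk≡ : + (m ℕ.* k) ≡ M * K
  mk≡ = ℤ.pos-* m k
  2m≡ : + (2 ℕ.* m) ≡ + 2 * M
  2m≡ = ℤ.pos-* 2 m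
  eigenvalue-0 : x - M * + 1 + K * (M * + 1) ≡ t - + 0
  eigenvalue-0 = trans (cong (λ d → t - d - M * + 1 + K * (M * + 1)) D≡) (ring t K M)
    where
    ring : ∀ t K M → t - (K * M - M) - M * + 1 + K * (M * + 1) ≡ t - + 0
    ring = solve-∀
  eigenvalue-2mk-2m : x - M * - + 1 + K * (M * - + 1) ≡ t - + (2 ℕ.* m ℕ.* k ∸ 2 ℕ.* m)
  eigenvalue-2mk-2m = trans (cong (λ d → t - d - M * - + 1 + K * (M * - + 1)) D≡)
    (trans (ring t K M) (cong (_-_ t) (sym (trans (+-∸ (ℕ.m≤m*n (2 ℕ.* m) k))
                                                   (cong₂ _-_ (trans (ℤ.pos-* (2 ℕ.* m) k) (cong (_* K) 2m≡)) 2m≡)))))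
    where
    ring : ∀ t K M → t - (K * M - M) - M * - + 1 + K * (M * - + 1) ≡ t - (+ 2 * M * K - + 2 * M)
    ring = solve-∀
  eigenvalue-mk : x - M * + 1 ≡ t - + (m ℕ.* k)
  eigenvalue-mk = trans (cong (λ d → t - d - M * + 1) D≡) (trans (ring t K M) (cong (_-_ t) (sym mk≡)))
    where
    ring : ∀ t K M → t - (K * M - M) - M * + 1 ≡ t - M * K
    ring = solve-∀
  eigenvalue-mk-2m : x - M * - + 1 ≡ t - (+ (m ℕ.* k) - + (2 ℕ.* m))
  eigenvalue-mk-2m = trans (cong (λ d → t - d - M * - + 1) D≡)
    (trans (ring t K M) (cong (λ a → t - a) (sym (cong₂ _-_ mk≡ 2m≡))))
    where
    ring : ∀ t K M → t - (K * M - M) - M * - + 1 ≡ t - (M * K - + 2 * M)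
    ring = solve-∀
  eigenvalue-mk-m : x ≡ t - + (m ℕ.* k ∸ m)
  eigenvalue-mk-m = cong (λ a → t - + (a ∸ m)) (ℕ.*-comm k m)
  multiplicity : e ℕ.+ e ≡ 2 ℕ.* k ℕ.* m ∸ 2 ℕ.* k
  multiplicity = trans (cong (e ℕ.+_) (sym (ℕ.+-identityʳ e)))
                       (trans (ℕ.*-distribˡ-∸ 2 (k ℕ.* m) k) (cong (_∸ 2 ℕ.* k) (sym (ℕ.*-assoc 2 k m))))

theorem3p5 : (k m : ℕ) → 1 ≤ k → 1 ≤ m →
    ((t : ℤ) → charPoly (integratedLap (KM k m)) t
                 ≡ (t - + 0) ^ 1
                   * (t - + (2 ℕ.* m ℕ.* k)) ^ (k ∸ 1)
                   * (t - + (2 ℕ.* m ℕ.* k ∸ 2 ℕ.* m)) ^ (2 ℕ.* m ℕ.* k ∸ k))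
    × ((t : ℤ) → charPoly (integratedLap (KD k m)) t
                 ≡ (t - + (2 ℕ.* m ℕ.* k ∸ 2 ℕ.* m)) ^ 1
                   * (t - + 0) ^ 1
                   * (t - + (m ℕ.* k)) ^ (k ∸ 1)
                   * (t - (+ (m ℕ.* k) - + (2 ℕ.* m))) ^ (k ∸ 1)
                   * (t - + (m ℕ.* k ∸ m)) ^ (2 ℕ.* k ℕ.* m ∸ 2 ℕ.* k))
theorem3p5 (suc k′) (suc m′) _ _ = spectrum-KM k′ m′ , spectrum-KD k′ m′
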